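{- Let $k$ be a field of characteristic zero and $f\in k[x_1,\dots,x_m]$. For every $y\in k^m$ with $f(y)=0$, $\operatorname{rank}(T^2_y f)/2\leq\operatorname{dc}(f)$.
   Context: $T^2_y f=\left(\frac{\partial^2 f}{\partial x_i\partial x_j}(y)\right)_{1\le i,j\le m}$ is the Hessian of $f$ at $y$. $\operatorname{dc}(f)$ is the minimum $N$ such that there is an $N\times N$ matrix of affine linear functions of $x_1,\dots,x_m$ over $k$ whose determinant equals $f$. -}

module Defs where

open import Level using (Level; _⊔_)
open import Data.Nat using (ℕ; zero; suc)
open import Data.Fin using (Fin; zero; suc; punchIn; _≟_)
open import Data.Product using (Σ; ∃; _,_)
open import Relation.Nullary using (¬_; yes; no)
open import Algebra.Bundles using (CommutativeRing)

record Field (c ℓ : Level) : Set (Level.suc (c ⊔ ℓ)) where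
  field
    commRing : CommutativeRing c ℓ
  open CommutativeRing commRing public
  field
    1≉0     : ¬ (1# ≈ 0#)
    inverse : ∀ x → ¬ (x ≈ 0#) → Σ Carrier (λ y → x * y ≈ 1#)

module _ {c ℓ : Level} (F : Field c ℓ) where
  open Field F using (Carrier; _≈_; _+_; _*_; -_; 0#; 1#)

  natK : ℕ → Carrier
  natK zero    = 0#
  natK (suc n) = 1# + natK n

  CharZero : Set ℓ
  CharZero = ∀ n → ¬ (natK (suc n) ≈ 0#)

  ∑K : ∀ {n} → (Fin n → Carrier) → Carrier
  ∑K {zero}  g = 0#
  ∑K {suc n} g = g zero + ∑K (λ i → g (suc i))

  -- The polynomial ring k[x₁,…,x_m]: polynomial expressions modulo the
  -- congruence generated by the commutative-ring laws and the ring
  -- operations on constants (i.e. the free commutative k-algebra on m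
  -- generators).

  data Poly (m : ℕ) : Set c where
    con  : Carrier → Poly m
    var  : Fin m → Poly m
    _⊕_  : Poly m → Poly m → Poly m
    _⊗_  : Poly m → Poly m → Poly m
    ⊖_   : Poly m → Poly m

  infixl 6 _⊕_
  infixl 7 _⊗_
  infix  8 ⊖_
  infix  4 _≈ₚ_

  data _≈ₚ_ {m : ℕ} : Poly m → Poly m → Set (c ⊔ ℓ) where
    ≈-refl   : ∀ {p} → p ≈ₚ p
    ≈-sym    : ∀ {p q} → p ≈ₚ q → q ≈ₚ p
    ≈-trans  : ∀ {p q r} → p ≈ₚ q → q ≈ₚ r → p ≈ₚ r
    ⊕-cong   : ∀ {p p′ q q′} → p ≈ₚ p′ → q ≈ₚ q′ → p ⊕ q ≈ₚ p′ ⊕ q′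
    ⊗-cong   : ∀ {p p′ q q′} → p ≈ₚ p′ → q ≈ₚ q′ → p ⊗ q ≈ₚ p′ ⊗ q′
    ⊖-cong   : ∀ {p p′} → p ≈ₚ p′ → ⊖ p ≈ₚ ⊖ p′
    ⊕-assoc  : ∀ p q r → (p ⊕ q) ⊕ r ≈ₚ p ⊕ (q ⊕ r)
    ⊕-comm   : ∀ p q → p ⊕ q ≈ₚ q ⊕ p
    ⊕-idˡ    : ∀ p → con 0# ⊕ p ≈ₚ p
    ⊖-invˡ   : ∀ p → (⊖ p) ⊕ p ≈ₚ con 0#
    ⊗-assoc  : ∀ p q r → (p ⊗ q) ⊗ r ≈ₚ p ⊗ (q ⊗ r)
    ⊗-comm   : ∀ p q → p ⊗ q ≈ₚ q ⊗ p
    ⊗-idˡ    : ∀ p → con 1# ⊗ p ≈ₚ p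
    distribˡ : ∀ p q r → p ⊗ (q ⊕ r) ≈ₚ (p ⊗ q) ⊕ (p ⊗ r)
    con-cong : ∀ {a b} → a ≈ b → con a ≈ₚ con b
    con-+    : ∀ a b → con a ⊕ con b ≈ₚ con (a + b)
    con-*    : ∀ a b → con a ⊗ con b ≈ₚ con (a * b)
    con--    : ∀ a → ⊖ con a ≈ₚ con (- a)

  eval : ∀ {m} → (Fin m → Carrier) → Poly m → Carrier
  eval y (con a)  = a
  eval y (var i)  = y i
  eval y (p ⊕ q)  = eval y p + eval y q
  eval y (p ⊗ q)  = eval y p * eval y q
  eval y (⊖ p)    = - eval y p

  ∂ : ∀ {m} → Fin m → Poly m → Poly m
  ∂ i (con a)  = con 0#
  ∂ i (var j) with i ≟ j
  ... | yes _ = con 1#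
  ... | no  _ = con 0#
  ∂ i (p ⊕ q)  = ∂ i p ⊕ ∂ i q
  ∂ i (p ⊗ q)  = (∂ i p ⊗ q) ⊕ (p ⊗ ∂ i q)
  ∂ i (⊖ p)    = ⊖ ∂ i p

  hessian : ∀ {m} → Poly m → (Fin m → Carrier) → Fin m → Fin m → Carrier
  hessian f y i j = eval y (∂ i (∂ j f))

  LinIndep : ∀ {r m} → (Fin r → Fin m → Carrier) → Set (c ⊔ ℓ)
  LinIndep {r} {m} v =
    (a : Fin r → Carrier) → (∀ i → ∑K (λ l → a l * v l i) ≈ 0#) → ∀ l → a l ≈ 0#

  RankAtLeast : ∀ {m n} → (Fin m → Fin n → Carrier) → ℕ → Set (c ⊔ ℓ)
  RankAtLeast {m} {n} A r =
    Σ (Fin r → Fin n) (λ σ → LinIndep (λ l i → A i (σ l)))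

  altSum : ∀ {m n} → (Fin n → Poly m) → Poly m
  altSum {n = zero}  g = con 0#
  altSum {n = suc n} g = g zero ⊕ ⊖ altSum (λ j → g (suc j))

  det : ∀ {m} N → (Fin N → Fin N → Poly m) → Poly m
  det zero    M = con 1#
  det (suc N) M = altSum (λ j → M zero j ⊗ det N (λ i k → M (suc i) (punchIn j k)))

  ∑P : ∀ {m n} → (Fin n → Poly m) → Poly m
  ∑P {n = zero}  g = con 0#
  ∑P {n = suc n} g = g zero ⊕ ∑P (λ i → g (suc i))

  affine : ∀ {m} → Carrier → (Fin m → Carrier) → Poly m
  affine a₀ a = con a₀ ⊕ ∑P (λ l → con (a l) ⊗ var l)

  DetRep : ∀ {m} → Poly m → ℕ → Set (c ⊔ ℓ)
  DetRep {m} f N =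
    Σ (Fin N → Fin N → Carrier) λ a₀ →
    Σ (Fin N → Fin N → Fin m → Carrier) λ a →
      det N (λ i j → affine (a₀ i j) (a i j)) ≈ₚ f

module Submission where

-- Write f = det M with M an N×N matrix of affine polynomials. As f(y) = 0,
-- the rows of M(y) satisfy a nontrivial relation c; after moving a row with
-- cᵢ ≠ 0 to the top and replacing it by ℓ = Σₖ cₖ Mₖ, Laplace expansion gives
-- K·f = Σⱼ ± ℓⱼ Dⱼ with K ≠ 0 and Dⱼ the minors. Each ℓⱼ is affine and
-- vanishes at y, so T²_y(ℓⱼ Dⱼ) = ∇ℓⱼ ⊗ ∇Dⱼ + ∇Dⱼ ⊗ ∇ℓⱼ: the Hessian at y is
-- a sum of 2N rank-one matrices, and by the Steinitz exchange lemma its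
-- rank is at most 2N.

open import Level using (_⊔_; 0ℓ)
open import Algebra.Bundles using (CommutativeRing; RawRing)
open import Algebra.Solver.Ring.AlmostCommutativeRing
  using (_-Raw-AlmostCommutative⟶_; fromCommutativeRing)
open import Data.Nat as ℕ using (ℕ; zero; suc)
import Data.Nat.Properties as ℕ
open import Data.Fin using (Fin; zero; suc; punchIn; punchOut; _≟_; splitAt; toℕ; fromℕ<)
open import Data.Fin.Properties
  using (toℕ<n; toℕ-injective; toℕ-fromℕ<; suc-injective; punchInᵢ≢i; punchIn-punchOut; punchOut-punchIn; punchOut-cong)
open import Data.Fin.Permutation.Components using (transpose)
import Data.Fin.Permutation as Perm
open import Data.Maybe using (Maybe; just; nothing)
open import Data.Product using (Σ; _,_; proj₁; proj₂) renaming (_×_ to _×ₚ_)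
open import Data.Sum using (_⊎_; [_,_]′; inj₁; inj₂)
open import Data.Vec.Functional using (_∷_; _++_; tail; updateAt; insertAt)
open import Data.Vec.Functional.Properties using (updateAt-updates; updateAt-minimal; insertAt-lookup; insertAt-punchIn)
open import Function using (_∘_; const)
open import Relation.Binary.PropositionalEquality as ≡ using (_≡_; _≢_)
open import Relation.Nullary using (Dec; yes; no; ¬_)
open import Relation.Nullary.Decidable using (¬¬-excluded-middle; decidable-stable)
open import Relation.Nullary.Negation using (contradiction; ¬¬-map)

open import Defs using (Field; CharZero; natK; ∑K; LinIndep; RankAtLeast; DetRep; Poly; _≈ₚ_)

module IntegerCoefficientSolver {c ℓ} (R : CommutativeRing c ℓ) where
  open CommutativeRing R
  open import Algebra.Properties.Ring ring using (-‿distribˡ-*; -‿distribʳ-*; -‿involutive; -0#≈0#)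
  open import Algebra.Properties.AbelianGroup +-abelianGroup using (⁻¹-∙-comm)
  open import Algebra.Properties.CommutativeSemigroup +-commutativeSemigroup using (interchange)
  open import Algebra.Properties.Monoid.Mult +-monoid using (_×_; ×-homo-+)
  open import Algebra.Properties.Semiring.Mult semiring using (×1-homo-*)
  open import Relation.Binary.Reasoning.Setoid setoid

  -- The solver needs coefficients with decidable equality; an integer is
  -- encoded as a formal difference (p , n) of naturals, read as p·1 − n·1.
  Differences : RawRing 0ℓ 0ℓ
  Differences = record
    { Carrier = ℕ ×ₚ ℕ
    ; _≈_     = _≡_
    ; _+_     = λ { (p , n) (p′ , n′) → (p ℕ.+ p′ , n ℕ.+ n′) }
    ; _*_     = λ { (p , n) (p′ , n′) → (p ℕ.* p′ ℕ.+ n ℕ.* n′ , p ℕ.* n′ ℕ.+ n ℕ.* p′) }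
    ; -_      = λ { (p , n) → (n , p) }
    ; 0#      = (0 , 0)
    ; 1#      = (1 , 0)
    }

  ⟦_⟧ : ℕ ×ₚ ℕ → Carrier
  ⟦ (p , n) ⟧ = p × 1# - n × 1#

  -‿distrib-+ : ∀ a b → - (a + b) ≈ - a + - b
  -‿distrib-+ a b = sym (⁻¹-∙-comm a b)

  -‿interchange : ∀ a b c d → (a + b) - (c + d) ≈ (a - c) + (b - d)
  -‿interchange a b c d = trans (+-congˡ (-‿distrib-+ c d)) (interchange a b (- c) (- d))

  *-distrib-- : ∀ a b c d → (a - b) * (c - d) ≈ (a * c + b * d) - (a * d + b * c)
  *-distrib-- a b c d = begin
    (a - b) * (c - d)                          ≈⟨ distribʳ (c - d) a (- b) ⟩
    a * (c - d) + - b * (c - d)                ≈⟨ +-cong (distribˡ a c (- d)) (distribˡ (- b) c (- d)) ⟩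
    (a * c + a * - d) + (- b * c + - b * - d)  ≈⟨ +-cong (+-congˡ (sym (-‿distribʳ-* a d)))
                                                        (+-cong (sym (-‿distribˡ-* b c)) minus-minus) ⟩
    (a * c - a * d) + (- (b * c) + b * d)      ≈⟨ +-congˡ (+-comm (- (b * c)) (b * d)) ⟩
    (a * c - a * d) + (b * d - b * c)          ≈⟨ interchange (a * c) (- (a * d)) (b * d) (- (b * c)) ⟩
    (a * c + b * d) + (- (a * d) + - (b * c))  ≈⟨ +-congˡ (sym (-‿distrib-+ (a * d) (b * c))) ⟩
    (a * c + b * d) - (a * d + b * c)          ∎
    where
    minus-minus : - b * - d ≈ b * d
    minus-minus = trans (sym (-‿distribˡ-* b (- d)))
                        (trans (-‿cong (sym (-‿distribʳ-* b d))) (-‿involutive (b * d)))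

  -‿cancelʳ : ∀ a b d → (a + d) - (b + d) ≈ a - b
  -‿cancelʳ a b d = trans (-‿interchange a d b d) (trans (+-congˡ (-‿inverseʳ d)) (+-identityʳ _))

  difference-cong : ∀ a b c d → a + d ≈ c + b → a - b ≈ c - d
  difference-cong a b c d a+d≈c+b = begin
    a - b              ≈⟨ -‿cancelʳ a b d ⟨
    (a + d) - (b + d)  ≈⟨ +-congʳ a+d≈c+b ⟩
    (c + b) - (b + d)  ≈⟨ +-congˡ (-‿cong (+-comm b d)) ⟩
    (c + b) - (d + b)  ≈⟨ -‿cancelʳ c d b ⟩
    c - d              ∎

  ⟦⟧-homomorphism : Differences -Raw-AlmostCommutative⟶ fromCommutativeRing R
  ⟦⟧-homomorphism = record
    { ⟦_⟧    = ⟦_⟧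
    ; +-homo = λ { (p , n) (p′ , n′) →
        trans (+-cong (×-homo-+ 1# p p′) (-‿cong (×-homo-+ 1# n n′))) (-‿interchange _ _ _ _) }
    ; *-homo = λ { (p , n) (p′ , n′) → trans
        (+-cong (trans (×-homo-+ 1# (p ℕ.* p′) (n ℕ.* n′)) (+-cong (×1-homo-* p p′) (×1-homo-* n n′)))
                (-‿cong (trans (×-homo-+ 1# (p ℕ.* n′) (n ℕ.* p′)) (+-cong (×1-homo-* p n′) (×1-homo-* n p′)))))
        (sym (*-distrib-- _ _ _ _)) }
    ; -‿homo = λ { (p , n) → sym (trans (-‿distrib-+ _ _) (trans (+-congˡ (-‿involutive _)) (+-comm _ _))) }
    ; 0-homo = -‿inverseʳ 0#
    ; 1-homo = trans (+-congˡ -0#≈0#) (trans (+-identityʳ _) (+-identityʳ _))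
    }

  ⟦⟧-weaklyInjective : ∀ x y → Maybe (⟦ x ⟧ ≈ ⟦ y ⟧)
  ⟦⟧-weaklyInjective (p , n) (p′ , n′) with p ℕ.+ n′ ℕ.≟ p′ ℕ.+ n
  ... | yes eq = just (difference-cong _ _ _ _
                  (trans (sym (×-homo-+ 1# p n′)) (trans (reflexive (≡.cong (_× 1#) eq)) (×-homo-+ 1# p′ n))))
  ... | no _   = nothing

  open import Algebra.Solver.Ring Differences (fromCommutativeRing R) ⟦⟧-homomorphism ⟦⟧-weaklyInjective public
    using (solve; _:=_; _:+_; _:*_; :-_)

punchIn-punchOut-swap : ∀ {n} {a b : Fin (suc (suc n))} (a≢b : a ≢ b) (b≢a : b ≢ a) (k : Fin n) →
  punchIn a (punchIn (punchOut a≢b) k) ≡ punchIn b (punchIn (punchOut b≢a) k)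
punchIn-punchOut-swap {a = zero}  {zero}  a≢b b≢a k = contradiction ≡.refl a≢b
punchIn-punchOut-swap {a = zero}  {suc b} a≢b b≢a k = ≡.refl
punchIn-punchOut-swap {a = suc a} {zero}  a≢b b≢a k = ≡.refl
punchIn-punchOut-swap {suc n} {suc a} {suc b} a≢b b≢a zero    = ≡.refl
punchIn-punchOut-swap {suc n} {suc a} {suc b} a≢b b≢a (suc k) =
  ≡.cong suc (punchIn-punchOut-swap (a≢b ∘ ≡.cong suc) (b≢a ∘ ≡.cong suc) k)

module _ {n} (i j : Fin n) where

  transpose-matchˡ : transpose i j i ≡ j
  transpose-matchˡ with i ≟ i
  ... | yes _   = ≡.refl
  ... | no i≢i  = contradiction ≡.refl i≢i

  transpose-matchʳ : transpose i j j ≡ i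
  transpose-matchʳ with j ≟ i
  ... | yes j≡i = j≡i
  ... | no _ with j ≟ j
  ...   | yes _   = ≡.refl
  ...   | no j≢j  = contradiction ≡.refl j≢j

  transpose-other : ∀ {k} → k ≢ i → k ≢ j → transpose i j k ≡ k
  transpose-other {k} k≢i k≢j with k ≟ i
  ... | yes k≡i = contradiction k≡i k≢i
  ... | no _ with k ≟ j
  ...   | yes k≡j = contradiction k≡j k≢j
  ...   | no _    = ≡.refl

  transpose-involutive : ∀ k → transpose i j (transpose i j k) ≡ k
  transpose-involutive k = cases (k ≟ i) (k ≟ j)
    where
    cases : Dec (k ≡ i) → Dec (k ≡ j) → transpose i j (transpose i j k) ≡ k
    cases (yes ≡.refl) _          = ≡.trans (≡.cong (transpose i j) transpose-matchˡ) transpose-matchʳ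
    cases (no _)       (yes ≡.refl) = ≡.trans (≡.cong (transpose i j) transpose-matchʳ) transpose-matchˡ
    cases (no k≢i)     (no k≢j)     =
      ≡.trans (≡.cong (transpose i j) (transpose-other k≢i k≢j)) (transpose-other k≢i k≢j)

transpose-self : ∀ {n} (i k : Fin n) → transpose i i k ≡ k
transpose-self i k = cases (k ≟ i)
  where
  cases : Dec (k ≡ i) → transpose i i k ≡ k
  cases (yes ≡.refl) = transpose-matchˡ i i
  cases (no k≢i)     = transpose-other i i k≢i k≢i

++-suc : ∀ {a} {A : Set a} {m n} (f : Fin (suc m) → A) (g : Fin n → A) t → (f ++ g) (suc t) ≡ (tail f ++ g) t
++-suc {m = m} f g t with splitAt m t
... | inj₁ _ = ≡.refl
... | inj₂ _ = ≡.refl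

++-zipWith : ∀ {a b c} {A : Set a} {B : Set b} {C : Set c} (_∙_ : A → B → C) {m n}
  (f : Fin m → A) (g : Fin n → A) (f′ : Fin m → B) (g′ : Fin n → B) t →
  (f ++ g) t ∙ (f′ ++ g′) t ≡ ((λ i → f i ∙ f′ i) ++ (λ i → g i ∙ g′ i)) t
++-zipWith _∙_ {m} f g f′ g′ t with splitAt m t
... | inj₁ _ = ≡.refl
... | inj₂ _ = ≡.refl

return : ∀ {a} {A : Set a} → A → ¬ ¬ A
return x ¬x = ¬x x

infixl 1 _>>=_
_>>=_ : ∀ {a b} {A : Set a} {B : Set b} → ¬ ¬ A → (A → ¬ ¬ B) → ¬ ¬ B
(¬¬x >>= f) ¬y = ¬¬x (λ x → f x ¬y)

¬¬-all-or-counterexample : ∀ {a} n (P : Fin n → Set a) → ¬ ¬ ((∀ i → P i) ⊎ Σ (Fin n) (λ i → ¬ P i))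
¬¬-all-or-counterexample zero    P = return (inj₁ (λ ()))
¬¬-all-or-counterexample (suc n) P = ¬¬-excluded-middle >>= λ
  { (no ¬P₀) → return (inj₂ (zero , ¬P₀))
  ; (yes P₀) → ¬¬-all-or-counterexample n (P ∘ suc) >>= λ
      { (inj₁ all)        → return (inj₁ (λ { zero → P₀ ; (suc i) → all i }))
      ; (inj₂ (i , ¬Pᵢ)) → return (inj₂ (suc i , ¬Pᵢ)) } }

module Determinant {c ℓ} (R : CommutativeRing c ℓ) where
  open CommutativeRing R hiding (zero)
  open import Algebra.Properties.Ring ring using (-‿involutive; -0#≈0#; -‿distribˡ-*)
  open import Algebra.Properties.Semiring.Sum semiring public
  open import Algebra.Properties.Group +-group using (inverseˡ-unique)
  open IntegerCoefficientSolver R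
  open import Relation.Binary.Reasoning.Setoid setoid

  sum-zero : ∀ {n} {f : Fin n → Carrier} → (∀ i → f i ≈ 0#) → sum f ≈ 0#
  sum-zero {n} f≈0 = trans (sum-cong-≋ f≈0) (sum-replicate-zero n)

  sum-neg : ∀ {n} (f : Fin n → Carrier) → sum (λ i → - f i) ≈ - sum f
  sum-neg {zero}  f = sym -0#≈0#
  sum-neg {suc n} f = trans (+-congˡ (sum-neg (tail f))) (sym (-‿distrib-+ (f zero) (sum (tail f))))

  sum-++ : ∀ {m n} (f : Fin m → Carrier) (g : Fin n → Carrier) → sum (f ++ g) ≈ sum f + sum g
  sum-++ {zero}  f g = sym (+-identityˡ _)
  sum-++ {suc m} f g = begin
    f zero + sum (λ t → (f ++ g) (suc t))  ≡⟨ ≡.cong (f zero +_) (sum-cong-≗ (++-suc f g)) ⟩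
    f zero + sum (tail f ++ g)             ≈⟨ +-congˡ (sum-++ (tail f) g) ⟩
    f zero + (sum (tail f) + sum g)        ≈⟨ +-assoc _ _ _ ⟨
    sum f + sum g                          ∎

  Matrix : ℕ → Set c
  Matrix n = Fin n → Fin n → Carrier

  sign : ∀ {n} → Fin n → Carrier
  sign zero    = 1#
  sign (suc j) = - sign j

  altSum : ∀ {n} → (Fin n → Carrier) → Carrier
  altSum {zero}  g = 0#
  altSum {suc n} g = g zero + - altSum (λ j → g (suc j))

  minor : ∀ {N} → Matrix (suc N) → Fin (suc N) → Matrix N
  minor A j i k = A (suc i) (punchIn j k)

  det : ∀ N → Matrix N → Carrier
  det zero    A = 1#
  det (suc N) A = altSum (λ j → A zero j * det N (minor A j))

  altSum-cong : ∀ {n} {f g : Fin n → Carrier} → (∀ i → f i ≈ g i) → altSum f ≈ altSum g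
  altSum-cong {zero}  f≈g = refl
  altSum-cong {suc n} f≈g = +-cong (f≈g zero) (-‿cong (altSum-cong (f≈g ∘ suc)))

  altSum-zero : ∀ {n} {g : Fin n → Carrier} → (∀ j → g j ≈ 0#) → altSum g ≈ 0#
  altSum-zero {zero}  g≈0 = refl
  altSum-zero {suc n} g≈0 =
    trans (+-cong (g≈0 zero) (-‿cong (altSum-zero (g≈0 ∘ suc)))) (trans (+-identityˡ _) -0#≈0#)

  altSum≈sum-sign : ∀ {n} (g : Fin n → Carrier) → altSum g ≈ sum (λ j → sign j * g j)
  altSum≈sum-sign {zero}  g = refl
  altSum≈sum-sign {suc n} g = begin
    g zero + - altSum (tail g)                       ≈⟨ +-cong (sym (*-identityˡ (g zero))) (-‿cong (altSum≈sum-sign (tail g))) ⟩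
    1# * g zero + - sum (λ j → sign j * g (suc j))    ≈⟨ +-congˡ (sum-neg (λ j → sign j * g (suc j))) ⟨
    1# * g zero + sum (λ j → - (sign j * g (suc j)))  ≈⟨ +-congˡ (sum-cong-≋ (λ j → -‿distribˡ-* (sign j) (g (suc j)))) ⟩
    1# * g zero + sum (λ j → - sign j * g (suc j))    ∎

  altSum-linear : ∀ {n} (a b : Carrier) (f g : Fin n → Carrier) →
    altSum (λ j → a * f j + b * g j) ≈ a * altSum f + b * altSum g
  altSum-linear {zero}  a b f g = sym (trans (+-cong (zeroʳ a) (zeroʳ b)) (+-identityˡ 0#))
  altSum-linear {suc n} a b f g =
    trans (+-congˡ (-‿cong (altSum-linear a b (tail f) (tail g))))
          (solve 6 (λ a b x y u v → (a :* x :+ b :* y) :+ :- (a :* u :+ b :* v)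
                                  := a :* (x :+ :- u) :+ b :* (y :+ :- v))
                 refl a b (f zero) (g zero) (altSum (tail f)) (altSum (tail g)))

  det-cong : ∀ N {A B : Matrix N} → (∀ i j → A i j ≈ B i j) → det N A ≈ det N B
  det-cong zero    A≈B = refl
  det-cong (suc N) A≈B = altSum-cong (λ j → *-cong (A≈B zero j) (det-cong N (λ i k → A≈B (suc i) (punchIn j k))))

  det-linearRow : ∀ N (i : Fin N) {A B C : Matrix N} (a b : Carrier) →
    (∀ r → r ≢ i → ∀ j → A r j ≈ B r j) → (∀ r → r ≢ i → ∀ j → A r j ≈ C r j) →
    (∀ j → A i j ≈ a * B i j + b * C i j) → det N A ≈ a * det N B + b * det N C
  det-linearRow (suc N) zero {A} {B} {C} a b A≈B A≈C Aᵢ = begin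
    altSum (λ j → A zero j * det N (minor A j))
      ≈⟨ altSum-cong (λ j → *-cong (Aᵢ j) (det-cong N (λ i k → A≈B (suc i) (λ ()) (punchIn j k)))) ⟩
    altSum (λ j → (a * B zero j + b * C zero j) * det N (minor B j))
      ≈⟨ altSum-cong (λ j → distrib-scalars (B zero j) (C zero j) (det N (minor B j)) (det N (minor C j))
                              (det-cong N (λ i k → trans (sym (A≈B (suc i) (λ ()) _)) (A≈C (suc i) (λ ()) _)))) ⟩
    altSum (λ j → a * (B zero j * det N (minor B j)) + b * (C zero j * det N (minor C j)))
      ≈⟨ altSum-linear a b (λ j → B zero j * det N (minor B j)) (λ j → C zero j * det N (minor C j)) ⟩
    a * det (suc N) B + b * det (suc N) C ∎
    where
    distrib-scalars : ∀ x y d d′ → d ≈ d′ → (a * x + b * y) * d ≈ a * (x * d) + b * (y * d′)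
    distrib-scalars x y d d′ d≈d′ =
      trans (solve 5 (λ a x b y d → (a :* x :+ b :* y) :* d := a :* (x :* d) :+ b :* (y :* d)) refl a x b y d)
            (+-congˡ (*-congˡ (*-congˡ d≈d′)))
  det-linearRow (suc N) (suc i) {A} {B} {C} a b A≈B A≈C Aᵢ = begin
    altSum (λ j → A zero j * det N (minor A j))
      ≈⟨ altSum-cong (λ j → *-congˡ {A zero j} (det-linearRow N i {minor A j} {minor B j} {minor C j} a b
           (λ r r≢i k → A≈B (suc r) (r≢i ∘ suc-injective) (punchIn j k))
           (λ r r≢i k → A≈C (suc r) (r≢i ∘ suc-injective) (punchIn j k))
           (λ k → Aᵢ (punchIn j k)))) ⟩
    altSum (λ j → A zero j * (a * det N (minor B j) + b * det N (minor C j)))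
      ≈⟨ altSum-cong (λ j → trans (solve 5 (λ x a u b v → x :* (a :* u :+ b :* v) := a :* (x :* u) :+ b :* (x :* v))
                                         refl (A zero j) a (det N (minor B j)) b (det N (minor C j)))
                                  (+-cong (*-congˡ (*-congʳ (A≈B zero (λ ()) j))) (*-congˡ (*-congʳ (A≈C zero (λ ()) j))))) ⟩
    altSum (λ j → a * (B zero j * det N (minor B j)) + b * (C zero j * det N (minor C j)))
      ≈⟨ altSum-linear a b (λ j → B zero j * det N (minor B j)) (λ j → C zero j * det N (minor C j)) ⟩
    a * det (suc N) B + b * det (suc N) C ∎

  _[_]≔_ : ∀ {n} → Matrix n → Fin n → (Fin n → Carrier) → Matrix n
  A [ i ]≔ v = updateAt A i (const v)

  Alternating : ℕ → Set (c ⊔ ℓ)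
  Alternating N = ∀ (A : Matrix N) {i k} → i ≢ k → (∀ j → A i j ≈ A k j) → det N A ≈ 0#

  det-equalRows-minors : ∀ {N} → Alternating N → (A : Matrix (suc N)) {i k : Fin N} → i ≢ k →
    (∀ j → A (suc i) j ≈ A (suc k) j) → det (suc N) A ≈ 0#
  det-equalRows-minors alternating A i≢k Aᵢ≈Aₖ = altSum-zero (λ j →
    trans (*-congˡ {A zero j} (alternating (minor A j) i≢k (λ l → Aᵢ≈Aₖ (punchIn j l)))) (zeroʳ _))

  det-additiveRow : ∀ N (i : Fin N) {A B C : Matrix N} →
    (∀ r → r ≢ i → ∀ j → A r j ≈ B r j) → (∀ r → r ≢ i → ∀ j → A r j ≈ C r j) →
    (∀ j → A i j ≈ B i j + C i j) → det N A ≈ det N B + det N C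
  det-additiveRow N i A≈B A≈C Aᵢ =
    trans (det-linearRow N i 1# 1# A≈B A≈C (λ j → trans (Aᵢ j) (sym (+-cong (*-identityˡ _) (*-identityˡ _)))))
          (+-cong (*-identityˡ _) (*-identityˡ _))

  module TwoRows {N} (A : Matrix N) {i k : Fin N} (i≢k : i ≢ k) where

    S : (Fin N → Carrier) → (Fin N → Carrier) → Matrix N
    S x y = (A [ k ]≔ y) [ i ]≔ x

    S-i : ∀ x y → S x y i ≡ x
    S-i x y = updateAt-updates i (A [ k ]≔ y)

    S-k : ∀ x y → S x y k ≡ y
    S-k x y = ≡.trans (updateAt-minimal k i (A [ k ]≔ y) (i≢k ∘ ≡.sym)) (updateAt-updates k A)

    S-other : ∀ x y r → r ≢ i → r ≢ k → S x y r ≡ A r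
    S-other x y r r≢i r≢k = ≡.trans (updateAt-minimal r i _ r≢i) (updateAt-minimal r k A r≢k)

    S-offᵢ : ∀ x x′ y r → r ≢ i → S x y r ≡ S x′ y r
    S-offᵢ x x′ y r r≢i = ≡.trans (updateAt-minimal r i _ r≢i) (≡.sym (updateAt-minimal r i _ r≢i))

    S-offₖ : ∀ x y y′ r → r ≢ k → S x y r ≡ S x y′ r
    S-offₖ x y y′ r r≢k with r ≟ i
    ... | yes ≡.refl = ≡.trans (S-i x y) (≡.sym (S-i x y′))
    ... | no r≢i     = ≡.trans (S-other x y r r≢i r≢k) (≡.sym (S-other x y′ r r≢i r≢k))

    additiveᵢ : ∀ x x′ y → det N (S (λ j → x j + x′ j) y) ≈ det N (S x y) + det N (S x′ y)
    additiveᵢ x x′ y = det-additiveRow N i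
      (λ r r≢i j → reflexive (≡.cong-app (S-offᵢ _ x y r r≢i) j))
      (λ r r≢i j → reflexive (≡.cong-app (S-offᵢ _ x′ y r r≢i) j))
      (λ j → reflexive (≡.trans (≡.cong-app (S-i _ y) j)
                         (≡.cong₂ _+_ (≡.sym (≡.cong-app (S-i x y) j)) (≡.sym (≡.cong-app (S-i x′ y) j)))))

    additiveₖ : ∀ x y y′ → det N (S x (λ j → y j + y′ j)) ≈ det N (S x y) + det N (S x y′)
    additiveₖ x y y′ = det-additiveRow N k
      (λ r r≢k j → reflexive (≡.cong-app (S-offₖ x _ y r r≢k) j))
      (λ r r≢k j → reflexive (≡.cong-app (S-offₖ x _ y′ r r≢k) j))
      (λ j → reflexive (≡.trans (≡.cong-app (S-k x _) j)
                         (≡.cong₂ _+_ (≡.sym (≡.cong-app (S-k x y) j)) (≡.sym (≡.cong-app (S-k x y′) j)))))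

    -- Expand the zero determinant of S (u + v) (u + v) by additivity in rows i and k.
    det-S-antisymmetric : (∀ (B : Matrix N) → (∀ j → B i j ≈ B k j) → det N B ≈ 0#) →
      ∀ u v → det N (S u v) + det N (S v u) ≈ 0#
    det-S-antisymmetric alternating u v = begin
      det N (S u v) + det N (S v u)
        ≈⟨ +-cong (+-identityˡ _) (+-identityʳ _) ⟨
      (0# + det N (S u v)) + (det N (S v u) + 0#)
        ≈⟨ +-cong (+-congʳ (equal u)) (+-congˡ (equal v)) ⟨
      (det N (S u u) + det N (S u v)) + (det N (S v u) + det N (S v v))
        ≈⟨ +-cong (additiveₖ u u v) (additiveₖ v u v) ⟨
      det N (S u w) + det N (S v w)
        ≈⟨ additiveᵢ u v w ⟨
      det N (S w w)
        ≈⟨ equal w ⟩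
      0# ∎
      where
      w = λ j → u j + v j
      equal : ∀ x → det N (S x x) ≈ 0#
      equal x = alternating (S x x) (λ j → reflexive (≡.cong-app (≡.trans (S-i x x) (≡.sym (S-k x x))) j))

  det-swapRows : ∀ N (A : Matrix N) {i k} → i ≢ k →
    (∀ (B : Matrix N) → (∀ j → B i j ≈ B k j) → det N B ≈ 0#) →
    det N (A ∘ transpose i k) ≈ - det N A
  det-swapRows N A {i} {k} i≢k alternating = inverseˡ-unique _ _ (begin
    det N (A ∘ transpose i k) + det N A
      ≈⟨ +-cong (det-cong N (λ r j → reflexive (≡.cong-app (swapped≡Svu r) j)))
                (det-cong N (λ r j → reflexive (≡.cong-app (A≡Suv r) j))) ⟩
    det N (S v u) + det N (S u v)  ≈⟨ +-comm _ _ ⟩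
    det N (S u v) + det N (S v u)  ≈⟨ det-S-antisymmetric alternating u v ⟩
    0#                             ∎)
    where
    open TwoRows A i≢k
    u = A i
    v = A k
    A≡Suv : ∀ r → A r ≡ S u v r
    A≡Suv r with r ≟ i | r ≟ k
    ... | yes ≡.refl | _          = ≡.sym (S-i u v)
    ... | no _       | yes ≡.refl = ≡.sym (S-k u v)
    ... | no r≢i     | no r≢k     = ≡.sym (S-other u v r r≢i r≢k)
    swapped≡Svu : ∀ r → A (transpose i k r) ≡ S v u r
    swapped≡Svu r = cases (r ≟ i) (r ≟ k)
      where
      cases : Dec (r ≡ i) → Dec (r ≡ k) → A (transpose i k r) ≡ S v u r
      cases (yes ≡.refl) _            = ≡.trans (≡.cong A (transpose-matchˡ i k)) (≡.sym (S-i v u))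
      cases (no _)       (yes ≡.refl) = ≡.trans (≡.cong A (transpose-matchʳ i k)) (≡.sym (S-k v u))
      cases (no r≢i)     (no r≢k)     =
        ≡.trans (≡.cong A (transpose-other i k r≢i r≢k)) (≡.sym (S-other v u r r≢i r≢k))

  sign-punchOut : ∀ {n} {a b : Fin (suc (suc n))} (a≢b : a ≢ b) (b≢a : b ≢ a) →
    sign a * sign (punchOut a≢b) ≈ - (sign b * sign (punchOut b≢a))
  sign-punchOut {a = zero}  {zero}  a≢b b≢a = contradiction ≡.refl a≢b
  sign-punchOut {a = zero}  {suc b} a≢b b≢a =
    trans (*-identityˡ _) (sym (trans (-‿cong (*-identityʳ _)) (-‿involutive _)))
  sign-punchOut {a = suc a} {zero}  a≢b b≢a = trans (*-identityʳ _) (-‿cong (sym (*-identityˡ _)))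
  sign-punchOut {zero}  {suc zero} {suc zero} a≢b b≢a = contradiction ≡.refl a≢b
  sign-punchOut {suc n} {suc a}    {suc b}    a≢b b≢a =
    trans (negations (sign a) (sign (punchOut (a≢b ∘ ≡.cong suc))))
          (trans (sign-punchOut (a≢b ∘ ≡.cong suc) (b≢a ∘ ≡.cong suc))
                 (-‿cong (sym (negations (sign b) (sign (punchOut (b≢a ∘ ≡.cong suc)))))))
    where
    negations : ∀ x y → - x * - y ≈ x * y
    negations = solve 2 (λ x y → (:- x) :* (:- y) := x :* y) refl

  det-expand₂ : ∀ N (A : Matrix (suc (suc N))) →
    det (suc (suc N)) A ≈ sum (λ a → sum (λ j →
      sign a * sign j * (A zero a * A (suc zero) (punchIn a j) * det N (minor (minor A a) j))))
  det-expand₂ N A = begin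
    altSum (λ a → A zero a * altSum (λ j → r (punchIn a j) * D a j))
      ≈⟨ altSum≈sum-sign (λ a → A zero a * altSum (λ j → r (punchIn a j) * D a j)) ⟩
    sum (λ a → sign a * (A zero a * altSum (λ j → r (punchIn a j) * D a j)))
      ≈⟨ sum-cong-≋ (λ a → *-congˡ {sign a} (*-congˡ {A zero a} (altSum≈sum-sign (λ j → r (punchIn a j) * D a j)))) ⟩
    sum (λ a → sign a * (A zero a * sum (λ j → sign j * (r (punchIn a j) * D a j))))
      ≈⟨ sum-cong-≋ (λ a → trans (*-congˡ (*-distribˡ-sum (A zero a) (λ j → sign j * (r (punchIn a j) * D a j))))
                                 (*-distribˡ-sum (sign a) (λ j → A zero a * (sign j * (r (punchIn a j) * D a j))))) ⟩
    sum (λ a → sum (λ j → sign a * (A zero a * (sign j * (r (punchIn a j) * D a j)))))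
      ≈⟨ sum-cong-≋ (λ a → sum-cong-≋ (λ j → rearrange (sign a) (A zero a) (sign j) (r (punchIn a j)) (D a j))) ⟩
    sum (λ a → sum (λ j → sign a * sign j * (A zero a * r (punchIn a j) * D a j))) ∎
    where
    r = A (suc zero)
    D = λ a → det N ∘ minor (minor A a)
    rearrange : ∀ s x t y d → s * (x * (t * (y * d))) ≈ s * t * (x * y * d)
    rearrange = solve 5 (λ s x t y d → s :* (x :* (t :* (y :* d))) := s :* t :* (x :* y :* d)) refl

  det-replaceRow₀-sum : ∀ N (A : Matrix (suc N)) {m} (c : Fin m → Carrier) (v : Fin m → Fin (suc N) → Carrier) →
    det (suc N) (A [ zero ]≔ (λ j → sum (λ k → c k * v k j))) ≈ sum (λ k → c k * det (suc N) (A [ zero ]≔ v k))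
  det-replaceRow₀-sum N A c v = begin
    altSum (λ j → sum (λ k → c k * v k j) * D j)
      ≈⟨ altSum≈sum-sign (λ j → sum (λ k → c k * v k j) * D j) ⟩
    sum (λ j → sign j * (sum (λ k → c k * v k j) * D j))
      ≈⟨ sum-cong-≋ (λ j → *-congˡ {sign j} (*-distribʳ-sum (D j) (λ k → c k * v k j))) ⟩
    sum (λ j → sign j * sum (λ k → c k * v k j * D j))
      ≈⟨ sum-cong-≋ (λ j → *-distribˡ-sum (sign j) (λ k → c k * v k j * D j)) ⟩
    sum (λ j → sum (λ k → sign j * (c k * v k j * D j)))
      ≈⟨ ∑-comm (λ j k → sign j * (c k * v k j * D j)) ⟩
    sum (λ k → sum (λ j → sign j * (c k * v k j * D j)))
      ≈⟨ sum-cong-≋ (λ k → sum-cong-≋ (λ j → rearrange (sign j) (c k) (v k j) (D j))) ⟩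
    sum (λ k → sum (λ j → c k * (sign j * (v k j * D j))))
      ≈⟨ sum-cong-≋ (λ k → *-distribˡ-sum (c k) (λ j → sign j * (v k j * D j))) ⟨
    sum (λ k → c k * sum (λ j → sign j * (v k j * D j)))
      ≈⟨ sum-cong-≋ (λ k → *-congˡ {c k} (altSum≈sum-sign (λ j → v k j * D j))) ⟨
    sum (λ k → c k * altSum (λ j → v k j * D j)) ∎
    where
    D = det N ∘ minor A
    rearrange : ∀ s x y d → s * (x * y * d) ≈ x * (s * (y * d))
    rearrange = solve 4 (λ s x y d → s :* (x :* y :* d) := x :* (s :* (y :* d))) refl

  det-zeroColumn₀ : ∀ N (A : Matrix (suc N)) → (∀ i → A i zero ≈ 0#) → det (suc N) A ≈ 0#
  det-zeroColumn₀ zero    A A≈0 =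
    trans (+-cong (trans (*-congʳ (A≈0 zero)) (zeroˡ _)) refl) (trans (+-identityˡ _) -0#≈0#)
  det-zeroColumn₀ (suc N) A A≈0 = altSum-zero vanishing
    where
    vanishing : ∀ j → A zero j * det (suc N) (minor A j) ≈ 0#
    vanishing zero    = trans (*-congʳ (A≈0 zero)) (zeroˡ _)
    vanishing (suc j) = trans (*-congˡ {A zero (suc j)} (det-zeroColumn₀ N (minor A (suc j)) (A≈0 ∘ suc))) (zeroʳ _)

  det-clearedColumn₀ : ∀ N (A : Matrix (suc N)) → (∀ i → A (suc i) zero ≈ 0#) →
    det (suc N) A ≈ A zero zero * det N (λ i k → A (suc i) (suc k))
  det-clearedColumn₀ N A A≈0 = trans (+-congˡ (trans (-‿cong (rest≈0 N A A≈0)) -0#≈0#)) (+-identityʳ _)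
    where
    rest≈0 : ∀ N (A : Matrix (suc N)) → (∀ i → A (suc i) zero ≈ 0#) →
      altSum (λ j → A zero (suc j) * det N (minor A (suc j))) ≈ 0#
    rest≈0 zero     A A≈0 = refl
    rest≈0 (suc N′) A A≈0 = altSum-zero (λ j →
      trans (*-congˡ {A zero (suc j)} (det-zeroColumn₀ N′ (minor A (suc j)) A≈0)) (zeroʳ _))

  addMultiplesOfRow₀ : ∀ {N} → Matrix (suc N) → (Fin N → Carrier) → Matrix (suc N)
  addMultiplesOfRow₀ A α zero    j = A zero j
  addMultiplesOfRow₀ A α (suc i) j = A (suc i) j + α i * A zero j

  -- For equal rows 0 and 1, expanding along both pairs each term with its
  -- negative, so T ≈ - T; inverting 2 is where characteristic zero is used.
  module _ (½ : Carrier) (½-inverse : ½ * (1# + 1#) ≈ 1#) where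

    self-negating : ∀ {x} → x ≈ - x → x ≈ 0#
    self-negating {x} x≈-x = begin
      x                  ≈⟨ *-identityˡ x ⟨
      1# * x             ≈⟨ *-congʳ ½-inverse ⟨
      ½ * (1# + 1#) * x  ≈⟨ solve 3 (λ h u t → h :* (u :+ u) :* t := h :* (u :* t :+ u :* t)) refl ½ 1# x ⟩
      ½ * (1# * x + 1# * x)  ≈⟨ *-congˡ (+-cong (*-identityˡ x) (trans (*-identityˡ x) x≈-x)) ⟩
      ½ * (x + - x)      ≈⟨ *-congˡ (-‿inverseʳ x) ⟩
      ½ * 0#             ≈⟨ zeroʳ ½ ⟩
      0#                 ∎

    sum-antisymmetric : ∀ {n} (h : Fin (suc n) → Fin n → Carrier) →
      (∀ {a b} (a≢b : a ≢ b) (b≢a : b ≢ a) → h a (punchOut a≢b) ≈ - h b (punchOut b≢a)) →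
      sum (λ a → sum (h a)) ≈ 0#
    sum-antisymmetric {n} h h-anti = begin
      sum (λ a → sum (h a))  ≈⟨ sum-cong-≋ row ⟨
      T                      ≈⟨ self-negating T≈-T ⟩
      0#                     ∎
      where
      F : Fin (suc n) → Fin (suc n) → Carrier
      F a b with a ≟ b
      ... | yes _   = 0#
      ... | no a≢b  = h a (punchOut a≢b)
      F-anti : ∀ a b → F a b ≈ - F b a
      F-anti a b with a ≟ b | b ≟ a
      ... | yes _    | yes _    = sym -0#≈0#
      ... | yes a≡b  | no b≢a   = contradiction (≡.sym a≡b) b≢a
      ... | no a≢b   | yes b≡a  = contradiction (≡.sym b≡a) a≢b
      ... | no a≢b   | no b≢a   = h-anti a≢b b≢a
      F-diag : ∀ a → F a a ≈ 0#
      F-diag a with a ≟ a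
      ... | yes _   = refl
      ... | no a≢a  = contradiction ≡.refl a≢a
      F-punchIn : ∀ a j → F a (punchIn a j) ≈ h a j
      F-punchIn a j with a ≟ punchIn a j
      ... | yes a≡ = contradiction (≡.sym a≡) (punchInᵢ≢i a j)
      ... | no _   = reflexive (≡.cong (h a) (≡.trans (punchOut-cong a ≡.refl) (punchOut-punchIn a)))
      row : ∀ a → sum (F a) ≈ sum (h a)
      row a = begin
        sum (F a)                           ≈⟨ sum-remove {i = a} (F a) ⟩
        F a a + sum (λ j → F a (punchIn a j))  ≈⟨ +-cong (F-diag a) (sum-cong-≋ (F-punchIn a)) ⟩
        0# + sum (h a)                      ≈⟨ +-identityˡ _ ⟩
        sum (h a)                           ∎
      T = sum (λ a → sum (F a))
      T≈-T : T ≈ - T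
      T≈-T = begin
        T                                  ≈⟨ sum-cong-≋ (λ a → sum-cong-≋ (F-anti a)) ⟩
        sum (λ a → sum (λ b → - F b a))    ≈⟨ sum-cong-≋ (λ a → sum-neg (λ b → F b a)) ⟩
        sum (λ a → - sum (λ b → F b a))    ≈⟨ sum-neg (λ a → sum (λ b → F b a)) ⟩
        - sum (λ a → sum (λ b → F b a))    ≈⟨ -‿cong (∑-comm F) ⟨
        - T                                ∎

    det-equalRows₀₁ : ∀ N (A : Matrix (suc (suc N))) → (∀ j → A zero j ≈ A (suc zero) j) →
      det (suc (suc N)) A ≈ 0#
    det-equalRows₀₁ N A A₀≈A₁ = begin
      det (suc (suc N)) A  ≈⟨ det-expand₂ N A ⟩
      sum (λ a → sum (λ j → sign a * sign j * (A zero a * r (punchIn a j) * D a j)))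
        ≈⟨ sum-cong-≋ (λ a → sum-cong-≋ (λ j →
             *-congˡ {sign a * sign j} (*-congʳ {D a j} (*-congʳ {r (punchIn a j)} (A₀≈A₁ a))))) ⟩
      sum (λ a → sum (h a)) ≈⟨ sum-antisymmetric h h-anti ⟩
      0#                   ∎
      where
      r = A (suc zero)
      D = λ a → det N ∘ minor (minor A a)
      h : Fin (suc (suc N)) → Fin (suc N) → Carrier
      h a j = sign a * sign j * (r a * r (punchIn a j) * D a j)
      h-anti : ∀ {a b} (a≢b : a ≢ b) (b≢a : b ≢ a) → h a (punchOut a≢b) ≈ - h b (punchOut b≢a)
      h-anti {a} {b} a≢b b≢a = begin
        sign a * sign (punchOut a≢b) * (r a * r (punchIn a (punchOut a≢b)) * D a (punchOut a≢b))
          ≈⟨ *-congˡ (*-cong (*-congˡ (reflexive (≡.cong r (punchIn-punchOut a≢b))))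
                            (det-cong N (λ i k → reflexive (≡.cong (A (suc (suc i))) (punchIn-punchOut-swap a≢b b≢a k))))) ⟩
        sign a * sign (punchOut a≢b) * (r a * r b * D b (punchOut b≢a))
          ≈⟨ *-cong (sign-punchOut a≢b b≢a) (*-congʳ (*-comm (r a) (r b))) ⟩
        - (sign b * sign (punchOut b≢a)) * (r b * r a * D b (punchOut b≢a))
          ≈⟨ -‿distribˡ-* _ _ ⟨
        - (sign b * sign (punchOut b≢a) * (r b * r a * D b (punchOut b≢a)))
          ≈⟨ -‿cong (*-congˡ (*-congʳ (*-congˡ (reflexive (≡.cong r (≡.sym (punchIn-punchOut b≢a))))))) ⟩
        - h b (punchOut b≢a) ∎

    det-equalRow₀ : ∀ N → Alternating N → (A : Matrix (suc N)) (k : Fin N) →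
      (∀ j → A zero j ≈ A (suc k) j) → det (suc N) A ≈ 0#
    det-equalRow₀ (suc N) alternating A zero    A≈ = det-equalRows₀₁ N A A≈
    det-equalRow₀ (suc N) alternating A (suc k) A≈ = begin
      det _ A      ≈⟨ -‿involutive _ ⟨
      - - det _ A  ≈⟨ -‿cong swapped ⟨
      - det _ B    ≈⟨ -‿cong (det-equalRows₀₁ N B B₀≈B₁) ⟩
      - 0#         ≈⟨ -0#≈0# ⟩
      0#           ∎
      where
      B = A ∘ transpose (suc zero) (suc (suc k))
      swapped : det _ B ≈ - det _ A
      swapped = det-swapRows _ A (λ ()) (λ C → det-equalRows-minors alternating C {zero} {suc k} (λ ()))
      B₀≈B₁ : ∀ j → B zero j ≈ B (suc zero) j
      B₀≈B₁ j = trans (reflexive (≡.cong (λ r → A r j) (transpose-other (suc zero) (suc (suc k)) (λ ()) (λ ()))))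
                      (trans (A≈ j) (reflexive (≡.cong (λ r → A r j) (≡.sym (transpose-matchˡ (suc zero) (suc (suc k)))))))

    det-alternating : ∀ N → Alternating N
    det-alternating (suc N) A {zero}  {zero}  0≢0 _ = contradiction ≡.refl 0≢0
    det-alternating (suc N) A {suc i} {suc k} i≢k A≈ = det-equalRows-minors (det-alternating N) A (i≢k ∘ ≡.cong suc) A≈
    det-alternating (suc N) A {suc i} {zero}  _   A≈ = det-equalRow₀ N (det-alternating N) A i (λ j → sym (A≈ j))
    det-alternating (suc N) A {zero}  {suc k} _   A≈ = det-equalRow₀ N (det-alternating N) A k A≈

    det-addRowMultiple : ∀ N {A B : Matrix N} {i k} (a : Carrier) → i ≢ k →
      (∀ r → r ≢ i → ∀ j → B r j ≈ A r j) → (∀ j → B i j ≈ A i j + a * A k j) → det N B ≈ det N A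
    det-addRowMultiple N {A} {B} {i} {k} a i≢k B≈A Bᵢ = begin
      det N B                     ≈⟨ det-linearRow N i 1# a B≈A B≈C
                                       (λ j → trans (Bᵢ j) (+-cong (sym (*-identityˡ _)) (*-congˡ (Cᵢ j)))) ⟩
      1# * det N A + a * det N C  ≈⟨ +-cong (*-identityˡ _) (trans (*-congˡ C-singular) (zeroʳ a)) ⟩
      det N A + 0#             ≈⟨ +-identityʳ _ ⟩
      det N A                  ∎
      where
      C = A [ i ]≔ A k
      Cᵢ : ∀ j → A k j ≈ C i j
      Cᵢ j = reflexive (≡.sym (≡.cong-app (updateAt-updates i A) j))
      C-off : ∀ r → r ≢ i → ∀ j → C r j ≈ A r j
      C-off r r≢i j = reflexive (≡.cong-app (updateAt-minimal r i A r≢i) j)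
      B≈C : ∀ r → r ≢ i → ∀ j → B r j ≈ C r j
      B≈C r r≢i j = trans (B≈A r r≢i j) (sym (C-off r r≢i j))
      C-singular : det N C ≈ 0#
      C-singular = det-alternating N C i≢k (λ j → trans (sym (Cᵢ j)) (sym (C-off k (i≢k ∘ ≡.sym) j)))

    det-replaceRow₀-combination : ∀ N (A : Matrix (suc N)) (c : Fin (suc N) → Carrier) →
      det (suc N) (A [ zero ]≔ (λ j → sum (λ k → c k * A k j))) ≈ c zero * det (suc N) A
    det-replaceRow₀-combination N A c = begin
      det (suc N) (A [ zero ]≔ (λ j → sum (λ k → c k * A k j)))
        ≈⟨ det-replaceRow₀-sum N A c A ⟩
      c zero * det (suc N) A + sum (λ k → c (suc k) * det (suc N) (A [ zero ]≔ A (suc k)))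
        ≈⟨ +-congˡ (sum-zero (λ k → trans (*-congˡ {c (suc k)} (repeated k)) (zeroʳ _))) ⟩
      c zero * det (suc N) A + 0#  ≈⟨ +-identityʳ _ ⟩
      c zero * det (suc N) A       ∎
      where
      repeated : ∀ k → det (suc N) (A [ zero ]≔ A (suc k)) ≈ 0#
      repeated k = det-alternating (suc N) (A [ zero ]≔ A (suc k)) {zero} {suc k} (λ ()) (λ j → refl)

    det-addMultiplesOfRow₀ : ∀ N (A : Matrix (suc N)) (α : Fin N → Carrier) →
      det (suc N) (addMultiplesOfRow₀ A α) ≈ det (suc N) A
    det-addMultiplesOfRow₀ N A α = supportedBelow N α (λ i N≤i → contradiction (toℕ<n i) (ℕ.≤⇒≯ N≤i))
      where
      supportedBelow : ∀ m α → (∀ i → m ℕ.≤ toℕ i → α i ≈ 0#) →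
        det (suc N) (addMultiplesOfRow₀ A α) ≈ det (suc N) A
      supportedBelow zero α α≈0 = det-cong (suc N) {addMultiplesOfRow₀ A α} {A} λ
        { zero    j → refl
        ; (suc i) j → trans (+-congˡ (trans (*-congʳ (α≈0 i ℕ.z≤n)) (zeroˡ _))) (+-identityʳ _) }
      supportedBelow (suc m) α α≈0 with m ℕ.<? N
      ... | no m≮N  = supportedBelow m α (λ i m≤i → contradiction (ℕ.≤-<-trans m≤i (toℕ<n i)) m≮N)
      ... | yes m<N = trans (det-addRowMultiple (suc N) {k = zero} (α i₀) (λ ()) off row) (supportedBelow m α′ α′≈0)
        where
        i₀ = fromℕ< m<N
        α′ = updateAt α i₀ (const 0#)
        off : ∀ r → r ≢ suc i₀ → ∀ j → addMultiplesOfRow₀ A α r j ≈ addMultiplesOfRow₀ A α′ r j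
        off zero    _     j = refl
        off (suc i) i≢i₀ j = +-congˡ (*-congʳ (reflexive (≡.sym (updateAt-minimal i i₀ α (i≢i₀ ∘ ≡.cong suc)))))
        row : ∀ j → addMultiplesOfRow₀ A α (suc i₀) j ≈ addMultiplesOfRow₀ A α′ (suc i₀) j + α i₀ * A zero j
        row j = +-congʳ (sym (trans (+-congˡ (trans (*-congʳ (reflexive (updateAt-updates i₀ α))) (zeroˡ _)))
                                    (+-identityʳ _)))
        α′≈0 : ∀ i → m ℕ.≤ toℕ i → α′ i ≈ 0#
        α′≈0 i m≤i with i ≟ i₀
        ... | yes ≡.refl = reflexive (updateAt-updates i₀ α)
        ... | no i≢i₀    = trans (reflexive (updateAt-minimal i i₀ α i≢i₀))
                                 (α≈0 i (ℕ.≤∧≢⇒< m≤i (λ m≡i → i≢i₀ (toℕ-injective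
                                   (≡.trans (≡.sym m≡i) (≡.sym (toℕ-fromℕ< m<N)))))))

    det-transposeRows : ∀ N (A : Matrix N) i k →
      det N (A ∘ transpose i k) ≈ det N A ⊎ det N (A ∘ transpose i k) ≈ - det N A
    det-transposeRows N A i k with i ≟ k
    ... | yes ≡.refl = inj₁ (det-cong N (λ r j → reflexive (≡.cong (λ s → A s j) (transpose-self i r))))
    ... | no i≢k     = inj₂ (det-swapRows N A i≢k (λ B → det-alternating N B i≢k))

module LinearAlgebra {c ℓ} (F : Field c ℓ) where
  open Field F hiding (zero)
  open Determinant commRing
  open IntegerCoefficientSolver commRing
  open import Algebra.Properties.Ring ring using (-‿distribˡ-*)
  open import Relation.Binary.Reasoning.Setoid setoid

  lincomb : ∀ {s m} → (Fin s → Carrier) → (Fin s → Fin m → Carrier) → Fin m → Carrier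
  lincomb a w i = sum (λ t → a t * w t i)

  -- Equality in F is not decidable, so the exchange argument below only
  -- yields ¬ ¬ (r ≤ s); independence is weakened accordingly.
  WeaklyIndependent : ∀ {r m} → (Fin r → Fin m → Carrier) → Set (c ⊔ ℓ)
  WeaklyIndependent v = ∀ a → (∀ i → lincomb a v i ≈ 0#) → ∀ l → ¬ ¬ (a l ≈ 0#)

  InSpan : ∀ {r s m} → (Fin r → Fin m → Carrier) → (Fin s → Fin m → Carrier) → (Fin r → Fin s → Carrier) → Set ℓ
  InSpan v w α = ∀ l i → v l i ≈ lincomb (α l) w i

  _⁻¹ : ∀ x → ¬ (x ≈ 0#) → Carrier
  (x ⁻¹) x≉0 = proj₁ (inverse x x≉0)

  ⁻¹-inverseʳ : ∀ x (x≉0 : ¬ (x ≈ 0#)) → x * (x ⁻¹) x≉0 ≈ 1#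
  ⁻¹-inverseʳ x x≉0 = proj₂ (inverse x x≉0)

  ⁻¹-inverseˡ : ∀ x (x≉0 : ¬ (x ≈ 0#)) → (x ⁻¹) x≉0 * x ≈ 1#
  ⁻¹-inverseˡ x x≉0 = trans (*-comm _ x) (⁻¹-inverseʳ x x≉0)

  x*y≈0⇒y≈0 : ∀ {x y} → ¬ (x ≈ 0#) → x * y ≈ 0# → y ≈ 0#
  x*y≈0⇒y≈0 {x} {y} x≉0 xy≈0 = begin
    y                  ≈⟨ *-identityˡ y ⟨
    1# * y             ≈⟨ *-congʳ (⁻¹-inverseˡ x x≉0) ⟨
    (x ⁻¹) x≉0 * x * y ≈⟨ *-assoc _ x y ⟩
    (x ⁻¹) x≉0 * (x * y) ≈⟨ *-congˡ xy≈0 ⟩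
    (x ⁻¹) x≉0 * 0#    ≈⟨ zeroʳ _ ⟩
    0#                 ∎

  module Exchange {r s m} (v : Fin (suc r) → Fin m → Carrier) (w : Fin (suc s) → Fin m → Carrier)
                  (α : Fin (suc r) → Fin (suc s) → Carrier) (p : Fin (suc r)) (αₚ≉0 : ¬ (α p zero ≈ 0#)) where

    γ : Fin r → Carrier
    γ l = α (punchIn p l) zero * (α p zero ⁻¹) αₚ≉0

    v′ : Fin r → Fin m → Carrier
    v′ l i = v (punchIn p l) i - γ l * v p i

    α′ : Fin r → Fin s → Carrier
    α′ l t = α (punchIn p l) (suc t) - γ l * α p (suc t)

    γ-pivot : ∀ l → γ l * α p zero ≈ α (punchIn p l) zero
    γ-pivot l = trans (*-assoc _ _ _) (trans (*-congˡ (⁻¹-inverseˡ _ αₚ≉0)) (*-identityʳ _))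

    v′-inSpan : InSpan v w α → InSpan v′ (w ∘ suc) α′
    v′-inSpan v∈w l i = begin
      v q i - γ l * v p i
        ≈⟨ +-cong (v∈w q i) (-‿cong (*-congˡ (v∈w p i))) ⟩
      (α q zero * w zero i + S q) - γ l * (α p zero * w zero i + S p)
        ≈⟨ solve 6 (λ x w₀ u g y u′ → (x :* w₀ :+ u) :+ :- (g :* (y :* w₀ :+ u′))
                                   := (x :+ :- (g :* y)) :* w₀ :+ (u :+ :- (g :* u′)))
                 refl (α q zero) (w zero i) (S q) (γ l) (α p zero) (S p) ⟩
      (α q zero - γ l * α p zero) * w zero i + (S q - γ l * S p)
        ≈⟨ +-congʳ (trans (*-congʳ (trans (+-congˡ (-‿cong (γ-pivot l))) (-‿inverseʳ _))) (zeroˡ _)) ⟩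
      0# + (S q - γ l * S p)
        ≈⟨ +-identityˡ _ ⟩
      S q - γ l * S p
        ≈⟨ +-congˡ (trans (-‿cong (*-distribˡ-sum (γ l) (λ t → α p (suc t) * w (suc t) i)))
                          (sym (sum-neg (λ t → γ l * (α p (suc t) * w (suc t) i))))) ⟩
      S q + sum (λ t → - (γ l * (α p (suc t) * w (suc t) i)))
        ≈⟨ ∑-distrib-+ (λ t → α q (suc t) * w (suc t) i) (λ t → - (γ l * (α p (suc t) * w (suc t) i))) ⟨
      sum (λ t → α q (suc t) * w (suc t) i - γ l * (α p (suc t) * w (suc t) i))
        ≈⟨ sum-cong-≋ (λ t → solve 4 (λ a g b x → a :* x :+ :- (g :* (b :* x)) := (a :+ :- (g :* b)) :* x)
                                      refl (α q (suc t)) (γ l) (α p (suc t)) (w (suc t) i)) ⟩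
      lincomb (α′ l) (w ∘ suc) i ∎
      where
      q = punchIn p l
      S : Fin (suc r) → Carrier
      S k = sum (λ t → α k (suc t) * w (suc t) i)

    v′-independent : WeaklyIndependent v → WeaklyIndependent v′
    v′-independent independent a′ a′v′≈0 l =
      ≡.subst (λ x → ¬ ¬ (x ≈ 0#)) (insertAt-punchIn a′ p (- G) l) (independent a av≈0 (punchIn p l))
      where
      G = sum (λ l → a′ l * γ l)
      a = insertAt a′ p (- G)
      av≈0 : ∀ i → lincomb a v i ≈ 0#
      av≈0 i = begin
        lincomb a v i
          ≈⟨ sum-remove {i = p} (λ l → a l * v l i) ⟩
        a p * v p i + sum (λ l → a (punchIn p l) * v (punchIn p l) i)
          ≈⟨ +-cong (*-congʳ (reflexive (insertAt-lookup a′ p (- G))))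
                    (sum-cong-≋ (λ l → *-congʳ (reflexive (insertAt-punchIn a′ p (- G) l)))) ⟩
        - G * v p i + sum (λ l → a′ l * v (punchIn p l) i)
          ≈⟨ +-comm _ _ ⟩
        sum (λ l → a′ l * v (punchIn p l) i) + - G * v p i
          ≈⟨ +-congˡ (trans (sym (-‿distribˡ-* G (v p i))) (-‿cong (*-distribʳ-sum (v p i) (λ l → a′ l * γ l)))) ⟩
        sum (λ l → a′ l * v (punchIn p l) i) - sum (λ l → a′ l * γ l * v p i)
          ≈⟨ +-congˡ (sum-neg (λ l → a′ l * γ l * v p i)) ⟨
        sum (λ l → a′ l * v (punchIn p l) i) + sum (λ l → - (a′ l * γ l * v p i))
          ≈⟨ ∑-distrib-+ (λ l → a′ l * v (punchIn p l) i) (λ l → - (a′ l * γ l * v p i)) ⟨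
        sum (λ l → a′ l * v (punchIn p l) i - a′ l * γ l * v p i)
          ≈⟨ sum-cong-≋ (λ l → solve 4 (λ a x g y → a :* x :+ :- (a :* g :* y) := a :* (x :+ :- (g :* y)))
                                        refl (a′ l) (v (punchIn p l) i) (γ l) (v p i)) ⟩
        lincomb a′ v′ i
          ≈⟨ a′v′≈0 i ⟩
        0# ∎

  independent≤spanning : ∀ s {r m} (v : Fin r → Fin m → Carrier) (w : Fin s → Fin m → Carrier)
    (α : Fin r → Fin s → Carrier) → InSpan v w α → WeaklyIndependent v → ¬ ¬ (r ℕ.≤ s)
  independent≤spanning zero    {zero}  v w α v∈w independent = return ℕ.z≤n
  independent≤spanning zero    {suc r} v w α v∈w independent = λ _ → independent (λ _ → 1#) v₀≈0 zero 1≉0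
    where
    v₀≈0 : ∀ i → lincomb (λ _ → 1#) v i ≈ 0#
    v₀≈0 i = sum-zero (λ l → trans (*-identityˡ _) (v∈w l i))
  independent≤spanning (suc s) {zero}  v w α v∈w independent = return ℕ.z≤n
  independent≤spanning (suc s) {suc r} v w α v∈w independent =
    ¬¬-all-or-counterexample _ (λ l → α l zero ≈ 0#) >>= λ
      { (inj₁ α₀≈0) →
          independent≤spanning s v (w ∘ suc) (λ l → α l ∘ suc) (drop-w₀ α₀≈0) independent >>= λ r+1≤s →
                        return (ℕ.m≤n⇒m≤1+n r+1≤s)
      ; (inj₂ (p , αₚ≉0)) → let open Exchange v w α p αₚ≉0 in
          independent≤spanning s v′ (w ∘ suc) α′ (v′-inSpan v∈w) (v′-independent independent) >>= λ r≤s →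
          return (ℕ.s≤s r≤s) }
    where
    drop-w₀ : (∀ l → α l zero ≈ 0#) → InSpan v (w ∘ suc) (λ l → α l ∘ suc)
    drop-w₀ α₀≈0 l i = trans (v∈w l i) (trans (+-congʳ (trans (*-congʳ (α₀≈0 l)) (zeroˡ _))) (+-identityˡ _))

  NontrivialRelation : ∀ {r m} → (Fin r → Fin m → Carrier) → Set (c ⊔ ℓ)
  NontrivialRelation {r} v = Σ (Fin r → Carrier) λ a → Σ (Fin r) (λ l → ¬ (a l ≈ 0#)) ×ₚ (∀ i → lincomb a v i ≈ 0#)

  ¬independent⇒¬¬relation : ∀ {r m} (v : Fin r → Fin m → Carrier) → ¬ WeaklyIndependent v → ¬ ¬ NontrivialRelation v
  ¬independent⇒¬¬relation v ¬independent ¬relation =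
    ¬independent (λ a av≈0 l aₗ≉0 → ¬relation (a , (l , aₗ≉0) , av≈0))

  δ : ∀ {n} → Fin n → Fin n → Carrier
  δ t i with t ≟ i
  ... | yes _ = 1#
  ... | no _  = 0#

  lincomb-δ : ∀ {n} (a : Fin n → Carrier) i → lincomb a δ i ≈ a i
  lincomb-δ {suc n} a i = begin
    lincomb a δ i
      ≈⟨ sum-remove {i = i} (λ t → a t * δ t i) ⟩
    a i * δ i i + sum (λ k → a (punchIn i k) * δ (punchIn i k) i)
      ≈⟨ +-cong (*-congˡ δ-diag) (sum-zero (λ k → trans (*-congˡ (δ-off k)) (zeroʳ _))) ⟩
    a i * 1# + 0#
      ≈⟨ trans (+-identityʳ _) (*-identityʳ _) ⟩
    a i ∎
    where
    δ-diag : δ i i ≈ 1#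
    δ-diag with i ≟ i
    ... | yes _  = refl
    ... | no i≢i = contradiction ≡.refl i≢i
    δ-off : ∀ k → δ (punchIn i k) i ≈ 0#
    δ-off k with punchIn i k ≟ i
    ... | yes eq = contradiction eq (punchInᵢ≢i i k)
    ... | no _   = refl

  tooManyVectors⇒¬¬relation : ∀ {N} (v : Fin (suc N) → Fin N → Carrier) → ¬ ¬ NontrivialRelation v
  tooManyVectors⇒¬¬relation {N} v = ¬independent⇒¬¬relation v (λ independent →
    independent≤spanning N v δ v (λ l i → sym (lincomb-δ (v l) i)) independent (ℕ.<-irrefl ≡.refl))

  relation-transposeRows : ∀ {N m} (B : Fin N → Fin m → Carrier) i k →
    NontrivialRelation (B ∘ transpose i k) → NontrivialRelation B
  relation-transposeRows B i k (a , (l , aₗ≉0) , aB≈0) =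
      a ∘ transpose i k
    , (transpose i k l , ≡.subst (λ x → ¬ (a x ≈ 0#)) (≡.sym (transpose-involutive i k l)) aₗ≉0)
    , λ j → begin
      sum (λ r → a (τ r) * B r j)
        ≈⟨ ∑-permute (λ r → a (τ r) * B r j) (Perm.transpose i k) ⟩
      sum (λ r → a (τ (τ r)) * B (τ r) j)
        ≈⟨ sum-cong-≋ (λ r → *-congʳ (reflexive (≡.cong a (transpose-involutive i k r)))) ⟩
      sum (λ r → a r * B (τ r) j)
        ≈⟨ aB≈0 j ⟩
      0# ∎
    where τ = transpose i k

  lincomb-addMultiplesOfRow₀ : ∀ {N} (A : Matrix (suc N)) (α a : Fin N → Carrier) j →
    lincomb (sum (λ k → a k * α k) ∷ a) A j ≈ lincomb a (addMultiplesOfRow₀ A α ∘ suc) j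
  lincomb-addMultiplesOfRow₀ A α a j = begin
    sum (λ k → a k * α k) * A zero j + sum (λ k → a k * A (suc k) j)
      ≈⟨ +-congʳ (*-distribʳ-sum (A zero j) (λ k → a k * α k)) ⟩
    sum (λ k → a k * α k * A zero j) + sum (λ k → a k * A (suc k) j)
      ≈⟨ ∑-distrib-+ (λ k → a k * α k * A zero j) (λ k → a k * A (suc k) j) ⟨
    sum (λ k → a k * α k * A zero j + a k * A (suc k) j)
      ≈⟨ sum-cong-≋ (λ k → solve 4 (λ a x y z → a :* x :* y :+ a :* z := a :* (z :+ x :* y))
                                    refl (a k) (α k) (A zero j) (A (suc k) j)) ⟩
    lincomb a (addMultiplesOfRow₀ A α ∘ suc) j ∎

  module _ (½ : Carrier) (½-inverse : ½ * (1# + 1#) ≈ 1#) where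
    open import Algebra.Properties.Ring ring using (-0#≈0#)

    det≈0⇒¬¬rowRelation : ∀ N (B : Matrix N) → det N B ≈ 0# → ¬ ¬ NontrivialRelation B
    det≈0⇒¬¬rowRelation zero    B det≈0 = λ _ → 1≉0 det≈0
    det≈0⇒¬¬rowRelation (suc N) B det≈0 = ¬¬-all-or-counterexample (suc N) (λ i → B i zero ≈ 0#) >>= λ
      { (inj₁ column₀≈0) → tooManyVectors⇒¬¬relation (λ l i → B l (suc i)) >>= λ
          { (a , a≉0 , aB≈0) → return (a , a≉0 , λ
              { zero    → sum-zero (λ l → trans (*-congˡ {a l} (column₀≈0 l)) (zeroʳ _))
              ; (suc j) → aB≈0 j }) }
      ; (inj₂ (p , Bₚ₀≉0)) → pivot p Bₚ₀≉0 }
      where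
      pivot : ∀ p → ¬ (B p zero ≈ 0#) → ¬ ¬ NontrivialRelation B
      pivot p π≉0 = det≈0⇒¬¬rowRelation N L detL≈0 >>= λ { (a , (l , aₗ≉0) , aL≈0) →
        return (relation-transposeRows B zero p
          ( sum (λ k → a k * α k) ∷ a , (suc l , aₗ≉0)
          , λ j → trans (lincomb-addMultiplesOfRow₀ Bs α a j) (cleared a aL≈0 j))) }
        where
        Bs = B ∘ transpose zero p
        π = B p zero
        π≡ : Bs zero zero ≡ π
        π≡ = ≡.cong (λ r → B r zero) (transpose-matchˡ zero p)
        α : Fin N → Carrier
        α i = - (Bs (suc i) zero * (π ⁻¹) π≉0)
        B′ = addMultiplesOfRow₀ Bs α
        L : Matrix N
        L i k = B′ (suc i) (suc k)
        column₀-cleared : ∀ i → B′ (suc i) zero ≈ 0#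
        column₀-cleared i = begin
          Bs (suc i) zero + - (Bs (suc i) zero * (π ⁻¹) π≉0) * Bs zero zero
            ≈⟨ +-congˡ (*-congˡ (reflexive π≡)) ⟩
          Bs (suc i) zero + - (Bs (suc i) zero * (π ⁻¹) π≉0) * π
            ≈⟨ solve 3 (λ x b p → x :+ (:- (x :* b)) :* p := x :+ :- (x :* (b :* p)))
                       refl (Bs (suc i) zero) ((π ⁻¹) π≉0) π ⟩
          Bs (suc i) zero - Bs (suc i) zero * ((π ⁻¹) π≉0 * π)
            ≈⟨ +-congˡ (-‿cong (trans (*-congˡ (⁻¹-inverseˡ π π≉0)) (*-identityʳ _))) ⟩
          Bs (suc i) zero - Bs (suc i) zero
            ≈⟨ -‿inverseʳ _ ⟩
          0# ∎
        detBs≈0 : det (suc N) Bs ≈ 0#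
        detBs≈0 = [ (λ eq → trans eq det≈0) , (λ eq → trans eq (trans (-‿cong det≈0) -0#≈0#)) ]′
                  (det-transposeRows ½ ½-inverse (suc N) B zero p)
        detL≈0 : det N L ≈ 0#
        detL≈0 = x*y≈0⇒y≈0 π≉0 (begin
          π * det N L                ≈⟨ *-congʳ (reflexive (≡.sym π≡)) ⟩
          B′ zero zero * det N L     ≈⟨ det-clearedColumn₀ N B′ column₀-cleared ⟨
          det (suc N) B′             ≈⟨ det-addMultiplesOfRow₀ ½ ½-inverse N Bs α ⟩
          det (suc N) Bs             ≈⟨ detBs≈0 ⟩
          0#                         ∎)
        cleared : ∀ a → (∀ j → lincomb a L j ≈ 0#) → ∀ j → lincomb a (B′ ∘ suc) j ≈ 0#
        cleared a aL≈0 zero    = sum-zero (λ k → trans (*-congˡ {a k} (column₀-cleared k)) (zeroʳ _))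
        cleared a aL≈0 (suc j) = aL≈0 j

  ∑K≡sum : ∀ {n} (g : Fin n → Carrier) → ∑K F g ≡ sum g
  ∑K≡sum {zero}  g = ≡.refl
  ∑K≡sum {suc n} g = ≡.cong (g zero +_) (∑K≡sum (tail g))

  linIndep⇒weaklyIndependent : ∀ {r m} {v : Fin r → Fin m → Carrier} → LinIndep F v → WeaklyIndependent v
  linIndep⇒weaklyIndependent independent a av≈0 l =
    return (independent a (λ i → trans (reflexive (∑K≡sum (λ l → a l * _))) (av≈0 i)) l)

  rank-sumOfRankOnes : ∀ {m n s r} (H : Fin m → Fin n → Carrier)
    (x : Fin s → Fin m → Carrier) (z : Fin s → Fin n → Carrier) →
    (∀ a b → H a b ≈ sum (λ t → z t b * x t a)) → RankAtLeast F H r → ¬ ¬ (r ℕ.≤ s)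
  rank-sumOfRankOnes {s = s} H x z H≈ (σ , independent) =
    independent≤spanning s (λ l i → H i (σ l)) x (λ l t → z t (σ l)) (λ l i → H≈ i (σ l))
      (linIndep⇒weaklyIndependent independent)

module Polynomials {c ℓ} (F : Field c ℓ) (m : ℕ) where
  open Defs hiding (Field; CharZero; natK; ∑K; LinIndep; RankAtLeast)
  module K = Field F
  open K using (Carrier; 0#; 1#)

  P : Set c
  P = Poly F m

  infix 4 _≈P_
  _≈P_ : P → P → Set (c ⊔ ℓ)
  _≈P_ = _≈ₚ_ F

  polyRing : CommutativeRing c (c ⊔ ℓ)
  polyRing = record
    { Carrier = P ; _≈_ = _≈ₚ_ F ; _+_ = _⊕_ ; _*_ = _⊗_ ; -_ = ⊖_ ; 0# = con 0# ; 1# = con 1#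
    ; isCommutativeRing = record
      { isRing = record
        { +-isAbelianGroup = record
          { isGroup = record
            { isMonoid = record
              { isSemigroup = record
                { isMagma = record
                  { isEquivalence = record { refl = ≈-refl ; sym = ≈-sym ; trans = ≈-trans }
                  ; ∙-cong = ⊕-cong }
                ; assoc = ⊕-assoc }
              ; identity = ⊕-idˡ , λ p → ≈-trans (⊕-comm p _) (⊕-idˡ p) }
            ; inverse = ⊖-invˡ , λ p → ≈-trans (⊕-comm p _) (⊖-invˡ p)
            ; ⁻¹-cong = ⊖-cong }
          ; comm = ⊕-comm }
        ; *-cong = ⊗-cong
        ; *-assoc = ⊗-assoc
        ; *-identity = ⊗-idˡ , λ p → ≈-trans (⊗-comm p _) (⊗-idˡ p)
        ; distrib = distribˡ , λ p q r →
            ≈-trans (⊗-comm (q ⊕ r) p) (≈-trans (distribˡ p q r) (⊕-cong (⊗-comm p q) (⊗-comm p r))) }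
      ; *-comm = ⊗-comm } }

  module PR = CommutativeRing polyRing
  module DP = Determinant polyRing
  module DK = Determinant K.commRing
  open IntegerCoefficientSolver polyRing
  open import Algebra.Properties.Ring PR.ring using (-0#≈0#)

  eval-cong : ∀ (z : Fin m → Carrier) {p q : P} → p ≈P q → eval F z p K.≈ eval F z q
  eval-cong z ≈-refl           = K.refl
  eval-cong z (≈-sym e)        = K.sym (eval-cong z e)
  eval-cong z (≈-trans e e′)   = K.trans (eval-cong z e) (eval-cong z e′)
  eval-cong z (⊕-cong e e′)    = K.+-cong (eval-cong z e) (eval-cong z e′)
  eval-cong z (⊗-cong e e′)    = K.*-cong (eval-cong z e) (eval-cong z e′)
  eval-cong z (⊖-cong e)       = K.-‿cong (eval-cong z e)
  eval-cong z (⊕-assoc p q r)  = K.+-assoc _ _ _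
  eval-cong z (⊕-comm p q)     = K.+-comm _ _
  eval-cong z (⊕-idˡ p)        = K.+-identityˡ _
  eval-cong z (⊖-invˡ p)       = K.-‿inverseˡ _
  eval-cong z (⊗-assoc p q r)  = K.*-assoc _ _ _
  eval-cong z (⊗-comm p q)     = K.*-comm _ _
  eval-cong z (⊗-idˡ p)        = K.*-identityˡ _
  eval-cong z (distribˡ p q r) = K.distribˡ _ _ _
  eval-cong z (con-cong e)     = e
  eval-cong z (con-+ a b)      = K.refl
  eval-cong z (con-* a b)      = K.refl
  eval-cong z (con-- a)        = K.refl

  ∂-cong : ∀ i {p q : P} → p ≈P q → ∂ F i p ≈P ∂ F i q
  ∂-cong i ≈-refl           = ≈-refl
  ∂-cong i (≈-sym e)        = ≈-sym (∂-cong i e)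
  ∂-cong i (≈-trans e e′)   = ≈-trans (∂-cong i e) (∂-cong i e′)
  ∂-cong i (⊕-cong e e′)    = ⊕-cong (∂-cong i e) (∂-cong i e′)
  ∂-cong i (⊗-cong e e′)    = ⊕-cong (⊗-cong (∂-cong i e) e′) (⊗-cong e (∂-cong i e′))
  ∂-cong i (⊖-cong e)       = ⊖-cong (∂-cong i e)
  ∂-cong i (⊕-assoc p q r)  = ⊕-assoc _ _ _
  ∂-cong i (⊕-comm p q)     = ⊕-comm _ _
  ∂-cong i (⊕-idˡ p)        = ⊕-idˡ _
  ∂-cong i (⊖-invˡ p)       = ⊖-invˡ _
  ∂-cong i (⊗-assoc p q r)  =
    solve 6 (λ p q r dp dq dr → (dp :* q :+ p :* dq) :* r :+ (p :* q) :* dr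
                              := dp :* (q :* r) :+ p :* (dq :* r :+ q :* dr))
          ≈-refl p q r (∂ F i p) (∂ F i q) (∂ F i r)
  ∂-cong i (⊗-comm p q)     = solve 4 (λ p q dp dq → dp :* q :+ p :* dq := dq :* p :+ q :* dp) ≈-refl p q (∂ F i p) (∂ F i q)
  ∂-cong i (⊗-idˡ p)        = ≈-trans (⊕-cong (PR.zeroˡ p) (⊗-idˡ _)) (⊕-idˡ _)
  ∂-cong i (distribˡ p q r) =
    solve 6 (λ p q r dp dq dr → dp :* (q :+ r) :+ p :* (dq :+ dr) := (dp :* q :+ p :* dq) :+ (dp :* r :+ p :* dr))
          ≈-refl p q r (∂ F i p) (∂ F i q) (∂ F i r)
  ∂-cong i (con-cong e)     = ≈-refl
  ∂-cong i (con-+ a b)      = ⊕-idˡ _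
  ∂-cong i (con-* a b)      = ≈-trans (⊕-cong (PR.zeroˡ _) (PR.zeroʳ _)) (⊕-idˡ _)
  ∂-cong i (con-- a)        = -0#≈0#

  hessian-cong : ∀ {p q : P} → p ≈P q → ∀ z a b → hessian F p z a b K.≈ hessian F q z a b
  hessian-cong p≈q z a b = eval-cong z (∂-cong a (∂-cong b p≈q))

  altSum≡altSum : ∀ {n} (g : Fin n → P) → altSum F g ≡ DP.altSum g
  altSum≡altSum {zero}  g = ≡.refl
  altSum≡altSum {suc n} g = ≡.cong (λ s → g zero ⊕ ⊖ s) (altSum≡altSum (tail g))

  det≈det : ∀ N (M : Fin N → Fin N → P) → Defs.det F N M ≈P DP.det N M
  det≈det zero    M = ≈-refl
  det≈det (suc N) M = PR.trans (PR.reflexive (altSum≡altSum (λ j → M zero j ⊗ Defs.det F N (DP.minor M j))))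
    (DP.altSum-cong (λ j → ⊗-cong (≈-refl {p = M zero j}) (det≈det N (DP.minor M j))))

  eval-altSum : ∀ (z : Fin m → Carrier) {n} (g : Fin n → P) → eval F z (DP.altSum g) ≡ DK.altSum (λ j → eval F z (g j))
  eval-altSum z {zero}  g = ≡.refl
  eval-altSum z {suc n} g = ≡.cong (λ s → eval F z (g zero) K.+ K.- s) (eval-altSum z (tail g))

  eval-sum : ∀ (z : Fin m → Carrier) {n} (g : Fin n → P) → eval F z (DP.sum g) ≡ DK.sum (λ j → eval F z (g j))
  eval-sum z {zero}  g = ≡.refl
  eval-sum z {suc n} g = ≡.cong (eval F z (g zero) K.+_) (eval-sum z (tail g))

  ∂-altSum : ∀ a {n} (g : Fin n → P) → ∂ F a (DP.altSum g) ≡ DP.altSum (λ j → ∂ F a (g j))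
  ∂-altSum a {zero}  g = ≡.refl
  ∂-altSum a {suc n} g = ≡.cong (λ s → ∂ F a (g zero) ⊕ ⊖ s) (∂-altSum a (tail g))

  eval-det : ∀ (z : Fin m → Carrier) N (M : Fin N → Fin N → P) →
    eval F z (DP.det N M) K.≈ DK.det N (λ i j → eval F z (M i j))
  eval-det z zero    M = K.refl
  eval-det z (suc N) M = K.trans (K.reflexive (eval-altSum z (λ j → M zero j ⊗ DP.det N (DP.minor M j))))
    (DK.altSum-cong (λ j → K.*-congˡ {eval F z (M zero j)} (eval-det z N (DP.minor M j))))

  hessian-altSum : ∀ {n} (g : Fin n → P) z a b → hessian F (DP.altSum g) z a b ≡ DK.altSum (λ j → hessian F (g j) z a b)
  hessian-altSum g z a b = begin
    eval F z (∂ F a (∂ F b (DP.altSum g)))               ≡⟨ ≡.cong (eval F z ∘ ∂ F a) (∂-altSum b g) ⟩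
    eval F z (∂ F a (DP.altSum (λ j → ∂ F b (g j))))     ≡⟨ ≡.cong (eval F z) (∂-altSum a (λ j → ∂ F b (g j))) ⟩
    eval F z (DP.altSum (λ j → ∂ F a (∂ F b (g j))))     ≡⟨ eval-altSum z (λ j → ∂ F a (∂ F b (g j))) ⟩
    DK.altSum (λ j → hessian F (g j) z a b)              ∎
    where open ≡.≡-Reasoning

  Affine : P → Set (c ⊔ ℓ)
  Affine p = ∀ z a b → hessian F p z a b K.≈ 0#

  affine-con : ∀ k → Affine (con k)
  affine-con k z a b = K.refl

  affine-var : ∀ l → Affine (var l)
  affine-var l z a b with b ≟ l
  ... | yes _ = K.refl
  ... | no _  = K.refl

  affine-⊕ : ∀ p q → Affine p → Affine q → Affine (p ⊕ q)
  affine-⊕ p q p-affine q-affine z a b = K.trans (K.+-cong (p-affine z a b) (q-affine z a b)) (K.+-identityˡ 0#)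

  affine-con⊗ : ∀ k p → Affine p → Affine (con k ⊗ p)
  affine-con⊗ k p p-affine z a b = K.trans
    (K.+-cong (K.trans (K.+-cong (K.zeroˡ _) (K.zeroˡ _)) (K.+-identityˡ 0#))
              (K.trans (K.+-cong (K.zeroˡ _) (K.trans (K.*-congˡ (p-affine z a b)) (K.zeroʳ _))) (K.+-identityˡ 0#)))
    (K.+-identityˡ 0#)

  affine-sum : ∀ {n} (g : Fin n → P) → (∀ k → Affine (g k)) → Affine (DP.sum g)
  affine-sum {zero}  g g-affine = affine-con 0#
  affine-sum {suc n} g g-affine = affine-⊕ (g zero) (DP.sum (tail g)) (g-affine zero) (affine-sum (tail g) (g-affine ∘ suc))

  affine-∑P : ∀ {n} (g : Fin n → P) → (∀ k → Affine (g k)) → Affine (∑P F g)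
  affine-∑P {zero}  g g-affine = affine-con 0#
  affine-∑P {suc n} g g-affine = affine-⊕ (g zero) (∑P F (tail g)) (g-affine zero) (affine-∑P (tail g) (g-affine ∘ suc))

  affine-affine : ∀ a₀ (a : Fin m → Carrier) → Affine (affine F a₀ a)
  affine-affine a₀ a = affine-⊕ (con a₀) (∑P F (λ l → con (a l) ⊗ var l)) (affine-con a₀)
    (affine-∑P (λ l → con (a l) ⊗ var l) (λ l → affine-con⊗ (a l) (var l) (affine-var l)))

  hessian-con⊗ : ∀ k (p : P) z a b → hessian F (con k ⊗ p) z a b K.≈ k K.* hessian F p z a b
  hessian-con⊗ k p z a b = K.trans
    (K.+-cong (K.trans (K.+-cong (K.zeroˡ _) (K.zeroˡ _)) (K.+-identityˡ 0#))
              (K.trans (K.+-congʳ (K.zeroˡ _)) (K.+-identityˡ _)))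
    (K.+-identityˡ _)

  -- ∂ₐ∂_b(q p) = ∂ₐ∂_bq · p + ∂_bq · ∂ₐp + ∂ₐq · ∂_bp + q · ∂ₐ∂_bp, and the outer terms vanish at z.
  hessian-product-affine : ∀ (q p : P) z → Affine q → eval F z q K.≈ 0# → ∀ a b →
    hessian F (q ⊗ p) z a b K.≈
      eval F z (∂ F b q) K.* eval F z (∂ F a p) K.+ eval F z (∂ F a q) K.* eval F z (∂ F b p)
  hessian-product-affine q p z q-affine q≈0 a b = K.+-cong
    (K.trans (K.+-congʳ (K.trans (K.*-congʳ (q-affine z a b)) (K.zeroˡ _))) (K.+-identityˡ _))
    (K.trans (K.+-congˡ (K.trans (K.*-congʳ q≈0) (K.zeroˡ _))) (K.+-identityʳ _))

module Corollary {c ℓ} (F : Field c ℓ) (char0 : CharZero F) where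
  open Field F hiding (zero)
  open LinearAlgebra F
  open IntegerCoefficientSolver commRing
  open import Algebra.Properties.Ring ring using (-‿involutive; -0#≈0#)
  open import Relation.Binary.Reasoning.Setoid setoid

  ½ : Carrier
  ½ = (natK F 2 ⁻¹) (char0 1)

  ½-inverse : ½ * (1# + 1#) ≈ 1#
  ½-inverse = trans (*-comm ½ _) (trans (*-congʳ (+-congˡ (sym (+-identityʳ 1#)))) (⁻¹-inverseʳ (natK F 2) (char0 1)))

  module _ {m} (f : Poly F m) (y : Fin m → Carrier) {N} (M : Fin (suc N) → Fin (suc N) → Poly F m) where
    open Polynomials F m
    open Defs using (_⊗_; _⊕_; con; ⊖_; ⊗-cong; ⊗-idˡ; ⊗-assoc; con-*; con--; ⊖-cong; ≈-refl; ≈-trans; ∂; eval; hessian)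
    open DK using (Matrix; sum; sign; altSum)
    open import Algebra.Properties.Ring PR.ring using () renaming (-‿distribˡ-* to ⊖-distribˡ-⊗)

    B : Matrix (suc N)
    B i j = eval F y (M i j)

    ½-inverseₚ : con ½ ⊗ (con 1# ⊕ con 1#) ≈P con 1#
    ½-inverseₚ = ≈-trans (⊗-cong ≈-refl (Defs.con-+ 1# 1#)) (≈-trans (con-* _ _) (Defs.con-cong ½-inverse))

    ∇ : P → Fin m → Carrier
    ∇ p i = eval F y (∂ F i p)

    module Expansion (M-affine : ∀ i j → Affine (M i j)) (detM≈f : Defs.det F (suc N) M ≈P f)
                     (ρ : Fin (suc N) → Carrier) (i₀ : Fin (suc N)) (ρᵢ₀≉0 : ¬ (ρ i₀ ≈ 0#))
                     (ρB≈0 : ∀ j → lincomb ρ B j ≈ 0#) where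

      τ : Fin (suc N) → Fin (suc N)
      τ = transpose zero i₀

      Ms : Fin (suc N) → Fin (suc N) → P
      Ms = M ∘ τ

      ρ′ : Fin (suc N) → Carrier
      ρ′ = ρ ∘ τ

      ρ′₀≉0 : ¬ (ρ′ zero ≈ 0#)
      ρ′₀≉0 = ≡.subst (λ i → ¬ (ρ i ≈ 0#)) (≡.sym (transpose-matchˡ zero i₀)) ρᵢ₀≉0

      detMs≈f : Σ Carrier λ s → ¬ (s ≈ 0#) ×ₚ DP.det (suc N) Ms ≈P con s ⊗ f
      detMs≈f = [_,_]′
        (λ same → 1# , 1≉0 , PR.trans same (PR.trans detM≈f′ (PR.sym (⊗-idˡ f))))
        (λ negated → - 1# , -1≉0 , PR.trans negated (PR.trans (⊖-cong detM≈f′) ⊖f≈-1f))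
        (DP.det-transposeRows (con ½) ½-inverseₚ (suc N) M zero i₀)
        where
        detM≈f′ : DP.det (suc N) M ≈P f
        detM≈f′ = PR.trans (PR.sym (det≈det (suc N) M)) detM≈f
        -1≉0 : ¬ (- 1# ≈ 0#)
        -1≉0 -1≈0 = 1≉0 (trans (sym (-‿involutive 1#)) (trans (-‿cong -1≈0) -0#≈0#))
        ⊖f≈-1f : ⊖ f ≈P con (- 1#) ⊗ f
        ⊖f≈-1f = PR.trans (⊖-cong (PR.sym (⊗-idˡ f))) (PR.trans (⊖-distribˡ-⊗ (con 1#) f) (⊗-cong (con-- 1#) ≈-refl))

      s : Carrier
      s = proj₁ detMs≈f

      K : Carrier
      K = ρ′ zero * s

      K≉0 : ¬ (K ≈ 0#)
      K≉0 K≈0 = proj₁ (proj₂ detMs≈f) (x*y≈0⇒y≈0 ρ′₀≉0 K≈0)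

      -- ℓv = Σₖ ρ′ₖ Msₖ vanishes at y because ρ is a relation among the rows of M(y).
      ℓv : Fin (suc N) → P
      ℓv j = DP.sum (λ k → con (ρ′ k) ⊗ Ms k j)

      ℓv-affine : ∀ j → Affine (ℓv j)
      ℓv-affine j = affine-sum (λ k → con (ρ′ k) ⊗ Ms k j) (λ k → affine-con⊗ (ρ′ k) (Ms k j) (M-affine (τ k) j))

      ℓv-vanishes : ∀ j → eval F y (ℓv j) ≈ 0#
      ℓv-vanishes j = begin
        eval F y (ℓv j)                    ≡⟨ eval-sum y (λ k → con (ρ′ k) ⊗ Ms k j) ⟩
        sum (λ k → ρ (τ k) * B (τ k) j)   ≈⟨ DK.∑-permute (λ k → ρ k * B k j) (Perm.transpose zero i₀) ⟨
        lincomb ρ B j                     ≈⟨ ρB≈0 j ⟩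
        0#                                 ∎

      D : Fin (suc N) → P
      D j = DP.det N (DP.minor Ms j)

      scaled-expansion : con K ⊗ f ≈P DP.altSum (λ j → ℓv j ⊗ D j)
      scaled-expansion = PR.sym
        (PR.trans (DP.det-replaceRow₀-combination (con ½) ½-inverseₚ N Ms (con ∘ ρ′))
        (PR.trans (⊗-cong ≈-refl (proj₂ (proj₂ detMs≈f)))
        (PR.trans (PR.sym (⊗-assoc _ _ _)) (⊗-cong (con-* _ _) ≈-refl))))

      scaled-hessian : ∀ a b →
        K * hessian F f y a b ≈ altSum (λ j → ∇ (ℓv j) b * ∇ (D j) a + ∇ (ℓv j) a * ∇ (D j) b)
      scaled-hessian a b = begin
        K * hessian F f y a b                        ≈⟨ hessian-con⊗ K f y a b ⟨
        hessian F (con K ⊗ f) y a b                  ≈⟨ hessian-cong scaled-expansion y a b ⟩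
        hessian F (DP.altSum g) y a b                ≡⟨ hessian-altSum g y a b ⟩
        altSum (λ j → hessian F (g j) y a b)         ≈⟨ DK.altSum-cong (λ j →
                                                          hessian-product-affine (ℓv j) (D j) y (ℓv-affine j) (ℓv-vanishes j) a b) ⟩
        altSum (λ j → ∇ (ℓv j) b * ∇ (D j) a + ∇ (ℓv j) a * ∇ (D j) b) ∎
        where
        g : Fin (suc N) → P
        g j = ℓv j ⊗ D j

      K⁻¹ : Carrier
      K⁻¹ = (K ⁻¹) K≉0

      x : Fin (suc N ℕ.+ suc N) → Fin m → Carrier
      x = (λ j → ∇ (ℓv j)) ++ (λ j → ∇ (D j))

      zₗ zᵣ : Fin (suc N) → Fin m → Carrier
      zₗ j b = K⁻¹ * (sign j * ∇ (D j) b)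
      zᵣ j b = K⁻¹ * (sign j * ∇ (ℓv j) b)

      z : Fin (suc N ℕ.+ suc N) → Fin m → Carrier
      z = zₗ ++ zᵣ

      hessian-sumOfRankOnes : ∀ a b → hessian F f y a b ≈ sum (λ t → z t b * x t a)
      hessian-sumOfRankOnes a b = begin
        hessian F f y a b
          ≈⟨ trans (*-congʳ (⁻¹-inverseˡ K K≉0)) (*-identityˡ _) ⟨
        K⁻¹ * K * hessian F f y a b
          ≈⟨ trans (*-assoc _ _ _) (*-congˡ (scaled-hessian a b)) ⟩
        K⁻¹ * altSum (λ j → λb j * μa j + λa j * μb j)
          ≈⟨ *-congˡ (DK.altSum≈sum-sign (λ j → λb j * μa j + λa j * μb j)) ⟩
        K⁻¹ * sum (λ j → sign j * (λb j * μa j + λa j * μb j))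
          ≈⟨ DK.*-distribˡ-sum K⁻¹ (λ j → sign j * (λb j * μa j + λa j * μb j)) ⟩
        sum (λ j → K⁻¹ * (sign j * (λb j * μa j + λa j * μb j)))
          ≈⟨ DK.sum-cong-≋ (λ j → split (sign j) (λb j) (μa j) (λa j) (μb j)) ⟩
        sum (λ j → K⁻¹ * (sign j * μb j) * λa j + K⁻¹ * (sign j * λb j) * μa j)
          ≈⟨ DK.∑-distrib-+ (λ j → K⁻¹ * (sign j * μb j) * λa j) (λ j → K⁻¹ * (sign j * λb j) * μa j) ⟩
        sum (λ j → K⁻¹ * (sign j * μb j) * λa j) + sum (λ j → K⁻¹ * (sign j * λb j) * μa j)
          ≈⟨ DK.sum-++ (λ j → K⁻¹ * (sign j * μb j) * λa j) (λ j → K⁻¹ * (sign j * λb j) * μa j) ⟨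
        sum ((λ j → K⁻¹ * (sign j * μb j) * λa j) ++ (λ j → K⁻¹ * (sign j * λb j) * μa j))
          ≡⟨ DK.sum-cong-≗ (λ t → ≡.sym (++-zipWith (λ u v → u b * v a) zₗ zᵣ (λ j → ∇ (ℓv j)) (λ j → ∇ (D j)) t)) ⟩
        sum (λ t → z t b * x t a) ∎
        where
        λa = λ j → ∇ (ℓv j) a
        λb = λ j → ∇ (ℓv j) b
        μa = λ j → ∇ (D j) a
        μb = λ j → ∇ (D j) b
        split : ∀ σ l₁ m₁ l₂ m₂ →
          K⁻¹ * (σ * (l₁ * m₁ + l₂ * m₂)) ≈ K⁻¹ * (σ * m₂) * l₂ + K⁻¹ * (σ * l₁) * m₁
        split = solve 6 (λ k σ l₁ m₁ l₂ m₂ → k :* (σ :* (l₁ :* m₁ :+ l₂ :* m₂))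
                                         := k :* (σ :* m₂) :* l₂ :+ k :* (σ :* l₁) :* m₁) refl K⁻¹

  rank≤N+N : ∀ {m} (f : Poly F m) (y : Fin m → Carrier) → Defs.eval F y f ≈ 0# →
    ∀ {r} → RankAtLeast F (Defs.hessian F f y) r → ∀ N → DetRep F f N → ¬ ¬ (r ℕ.≤ N ℕ.+ N)
  rank≤N+N f y f[y]≈0 rank zero    (a₀ , a , det≈f) = λ _ → 1≉0 (trans (Polynomials.eval-cong F _ y det≈f) f[y]≈0)
  rank≤N+N {m} f y f[y]≈0 rank (suc N) (a₀ , a , det≈f) =
    det≈0⇒¬¬rowRelation ½ ½-inverse (suc N) (B f y M) detB≈0 >>= λ { (ρ , (i₀ , ρᵢ₀≉0) , ρB≈0) →
    let open Expansion f y M (λ i j → affine-affine (a₀ i j) (a i j)) det≈f ρ i₀ ρᵢ₀≉0 ρB≈0 in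
    rank-sumOfRankOnes (Defs.hessian F f y) x z hessian-sumOfRankOnes rank }
    where
    open Polynomials F m
    M : Fin (suc N) → Fin (suc N) → P
    M i j = Defs.affine F (a₀ i j) (a i j)
    detB≈0 : DK.det (suc N) (B f y M) ≈ 0#
    detB≈0 = begin
      DK.det (suc N) (B f y M)           ≈⟨ eval-det y (suc N) M ⟨
      Defs.eval F y (DP.det (suc N) M)   ≈⟨ eval-cong y (PR.trans (PR.sym (det≈det (suc N) M)) det≈f) ⟩
      Defs.eval F y f                    ≈⟨ f[y]≈0 ⟩
      0#                                 ∎

open import Defs using (eval; hessian)
open import Data.Nat using (_≤_; _*_)

corollary3p3 : ∀ {c ℓ} (F : Field c ℓ) → CharZero F →
    (m : ℕ) (f : Poly F m) (y : Fin m → Field.Carrier F) →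
    Field._≈_ F (eval F y f) (Field.0# F) →
    (r : ℕ) → RankAtLeast F (hessian F f y) r →
    (N : ℕ) → DetRep F f N →
    r ≤ 2 * N
corollary3p3 F char0 m f y f[y]≈0 r rank N rep = decidable-stable (r ℕ.≤? 2 * N)
  (¬¬-map (≡.subst (λ n → r ≤ N ℕ.+ n) (≡.sym (ℕ.+-identityʳ N)))
    (Corollary.rank≤N+N F char0 f y f[y]≈0 rank N rep))
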